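{- (Representability.) Let $\mathcal{R}$ be a representable signature and $\mathcal{F}(\mathcal{R})$ the multicategory of representable terms defined below. For all lists of types $\gamma,\delta$ and types $a_1,\dots,a_k,a$, the map $[s] \mapsto [s\{\langle x_1,\dots,x_k\rangle/x\}]$ (where $x$ is the variable of type $(a_1\otimes\cdots\otimes a_k)$ in the context and $x_1,\dots,x_k$ are fresh) is a well-defined bijection $\mathcal{F}(\mathcal{R})(\gamma, (a_1\otimes\cdots\otimes a_k), \delta; a) \cong \mathcal{F}(\mathcal{R})(\gamma, a_1,\dots,a_k,\delta; a)$, multinatural in $\gamma,\delta$ and natural in $a$.
   Context: A representable signature consists of a set $\mathcal{A}$ of atoms and a multigraph $\mathcal{R}$ whose nodes (types) are generated by $a ::= o \in \mathcal{A} \mid (a_1 \otimes \cdots \otimes a_k)$ for $k \in \mathbb{N}$, with sets $\mathcal{R}(a_1,\dots,a_n;b)$ of multiarrows. Representable terms: $s,t ::= x \mid \langle s_1,\dots,s_k\rangle \mid s[x_1^{a_1},\dots,x_k^{a_k} := t] \mid f(s_1,\dots,s_n)$; in $s[\vec{x} := t]$ the $x_i$ are bound in $s$; terms up to renaming of bound variables. Typing rules: $x:a \vdash x:a$; if $f \in \mathcal{R}(a_1,\dots,a_n;b)$ and $\gamma_i \vdash s_i : a_i$ then $\gamma_1,\dots,\gamma_n \vdash f(s_1,\dots,s_n) : b$; if $\gamma_i \vdash s_i : a_i$ then $\gamma_1,\dots,\gamma_k \vdash \langle s_1,\dots,s_k\rangle : (a_1\otimes\cdots\otimes a_k)$; if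 $\gamma \vdash t : (a_1 \otimes\cdots\otimes a_k)$ and $\delta, x_1:a_1,\dots,x_k:a_k, \delta' \vdash s : b$ then $\delta,\gamma,\delta' \vdash s[x_1^{a_1},\dots,x_k^{a_k} := t] : b$; combined contexts are disjoint lists of distinct variables. $\mathrm{Rep}(\mathcal{R})(a_1,\dots,a_n;a)$ is the set of terms $s$ with $x_1:a_1,\dots,x_n:a_n \vdash s : a$ (contexts up to renaming). Contexts with one hole: $\mathtt{C} ::= [\cdot] \mid \langle s_1,\dots,\mathtt{C},\dots,s_k\rangle \mid \mathtt{C}[\vec{x}:=t] \mid s[\vec{x} := \mathtt{C}] \mid f(s_1,\dots,\mathtt{C},\dots,s_n)$; $\mathtt{E}$ same grammar except that $s[\vec{x} := \mathtt{E}]$ requires $\mathtt{E} \neq [\cdot]$; $\mathtt{L} ::= [\cdot] \mid \mathtt{L}[\vec{x} := t]$; $\mathsf{LT}$ = terms $\mathtt{L}[\langle s_1,\dots,s_k\rangle]$. $\beta$: $s[x_1,\dots,x_k := \mathtt{L}[\langle t_1,\dots,t_k\rangle]] \to_\beta \mathtt{L}[s\{t_1/x_1,\dots,t_k/x_k\}]$ (capture-avoiding substitution), closed under $\mathtt{C}$-contexts; $\eta$: $s \to_\eta \langle x_1,\dots,x_k\rangle[x_1^{a_1},\dots,x_k^{a_k} := s]$ when $s$ has type $(a_1\otimes\cdots\otimes a_k)$, $x_i$ fresh, $s\notin\mathsf{LT}$, closed under $\mathtt{E}$-contexts; $\to_{\mathsf{rep}} = \to_\beta\cup\to_\eta$.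 Structural equivalence $\equiv$: the smallest congruence containing $\mathtt{C}[s[\vec{x}:=t]] \equiv \mathtt{C}[s][\vec{x}:=t]$ whenever $\mathtt{C}$ binds no free variable of $t$ and $\vec{x}$ do not occur free in $\mathtt{C}$. The multicategory $\mathcal{F}(\mathcal{R})$ has the types as objects, $\mathcal{F}(\mathcal{R})(\gamma;a) = \mathrm{Rep}(\mathcal{R})(\gamma;a)/\sim$ where $\sim$ is the equivalence relation generated by $\equiv$ and $\to_{\mathsf{rep}}$, composition $[s]\circ\langle [t_1],\dots,[t_n]\rangle = [s\{t_1/x_1,\dots,t_n/x_n\}]$ and identities $[x]$. -}

module Defs where

open import Data.List using (List; []; _∷_; _++_; [_])
open import Data.List.Properties using (++-assoc; ++-identityʳ; ∷-injective; ++-monoid)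
open import Tactic.MonoidSolver using (solve)
open import Data.Product using (Σ; _×_; _,_; proj₁; proj₂)
open import Data.Sum using (_⊎_; inj₁; inj₂)
open import Relation.Nullary using (¬_)
open import Relation.Binary.PropositionalEquality
  using (_≡_; refl; sym; trans; cong; subst)

data Ty (A : Set) : Set where
  atom   : A → Ty A
  tensor : List (Ty A) → Ty A

record Signature : Set₁ where
  field
    Atom : Set
    Arr  : List (Ty Atom) → Ty Atom → Set

split++ : ∀ {A : Set} (xs ys δ δ' : List A) (a : A) → xs ++ ys ≡ δ ++ a ∷ δ' →
  (Σ (List A) λ μ → (δ ≡ xs ++ μ) × (ys ≡ μ ++ a ∷ δ'))
  ⊎ (Σ (List A) λ μ → (xs ≡ δ ++ a ∷ μ) × (δ' ≡ μ ++ ys))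
split++ [] ys δ δ' a eq = inj₁ (δ , refl , eq)
split++ (x ∷ xs) ys [] δ' a refl = inj₂ (xs , refl , refl)
split++ (x ∷ xs) ys (d ∷ δ) δ' a eq with ∷-injective eq
... | refl , eq' with split++ xs ys δ δ' a eq'
... | inj₁ (μ , p , q) = inj₁ (μ , cong (x ∷_) p , q)
... | inj₂ (μ , p , q) = inj₂ (μ , cong (x ∷_) p , q)

assoc3 : ∀ {A : Set} (a b c d : List A) → a ++ (b ++ c) ++ d ≡ (a ++ b) ++ c ++ d
assoc3 a b c d = trans (cong (a ++_) (++-assoc b c d)) (sym (++-assoc a b (c ++ d)))

assoc4 : ∀ {A : Set} (a b c d e : List A) →
  a ++ (b ++ c ++ d) ++ e ≡ (a ++ b) ++ c ++ d ++ e
assoc4 a b c d e =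
  trans (cong (a ++_) (trans (++-assoc b (c ++ d) e) (cong (b ++_) (++-assoc c d e))))
        (sym (++-assoc a b (c ++ d ++ e)))

-- Contexts are ordered lists of types; every variable is used exactly
-- once and the context order is the one fixed by the typing rules, so a
-- term needs no variable names: a variable is the unique leaf `var`,
-- and a binder s[x₁,…,xₖ := t] records the position (δ, δ') of the bound
-- block x₁…xₖ in the context δ,x₁,…,xₖ,δ' of s.  This is α-equivalence
-- built in.

module Syntax (𝓡 : Signature) where
  open Signature 𝓡

  Type : Set
  Type = Ty Atom

  Ctx : Set
  Ctx = List Type

  data Tm : Ctx → Type → Set
  data Tms : Ctx → Ctx → Set

  data Tm where
    var  : ∀ {a} → Tm [ a ] a
    tup  : ∀ {γ as} → Tms γ as → Tm γ (tensor as)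
    op   : ∀ {γ as b} → Arr as b → Tms γ as → Tm γ b
    lett : ∀ {γ as b} (δ δ' : Ctx) → Tm (δ ++ as ++ δ') b → Tm γ (tensor as)
           → Tm (δ ++ γ ++ δ') b

  data Tms where
    []ₜ  : Tms [] []
    _∷ₜ_ : ∀ {γ Γ a as} → Tm γ a → Tms Γ as → Tms (γ ++ Γ) (a ∷ as)

  infixr 5 _∷ₜ_ _++ₜ_

  castTm : ∀ {Γ Γ' b} → Γ ≡ Γ' → Tm Γ b → Tm Γ' b
  castTm {b = b} = subst (λ Γ → Tm Γ b)

  castTm' : ∀ Γ Γ' {b} → Γ ≡ Γ' → Tm Γ b → Tm Γ' b
  castTm' Γ Γ' = castTm

  castTms : ∀ {Γ Γ' bs} → Γ ≡ Γ' → Tms Γ bs → Tms Γ' bs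
  castTms {bs = bs} = subst (λ Γ → Tms Γ bs)

  _++ₜ_ : ∀ {γ₁ γ₂ as₁ as₂} → Tms γ₁ as₁ → Tms γ₂ as₂ → Tms (γ₁ ++ γ₂) (as₁ ++ as₂)
  []ₜ ++ₜ us = us
  (_∷ₜ_ {γ} {Γ} t ts) ++ₜ us = castTms (sym (++-assoc γ Γ _)) (t ∷ₜ (ts ++ₜ us))

  vars : (as : Ctx) → Tms as as
  vars []       = []ₜ
  vars (a ∷ as) = var ∷ₜ vars as

  subVar : ∀ {a' γ a} (δ δ' : Ctx) → [ a' ] ≡ δ ++ a ∷ δ' → Tm γ a
           → Tm (δ ++ γ ++ δ') a'
  subVar {γ = γ} [] .[] refl u = castTm (sym (++-identityʳ γ)) u
  subVar (_ ∷ []) δ' () u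
  subVar (_ ∷ _ ∷ _) δ' () u

  sub  : ∀ {Δ γ a b} (δ δ' : Ctx) → Δ ≡ δ ++ a ∷ δ' → Tm Δ b → Tm γ a
         → Tm (δ ++ γ ++ δ') b
  subS : ∀ {Δ γ a bs} (δ δ' : Ctx) → Δ ≡ δ ++ a ∷ δ' → Tms Δ bs → Tm γ a
         → Tms (δ ++ γ ++ δ') bs

  sub δ δ' eq var u = subVar δ δ' eq u
  sub δ δ' eq (tup ts) u = tup (subS δ δ' eq ts u)
  sub δ δ' eq (op f ts) u = op f (subS δ δ' eq ts u)
  sub {γ = γ} {a = a} {b = b} δ δ' eq (lett {γ = Γt} {as = as} ε ε' s t) u
    with split++ ε (Γt ++ ε') δ δ' a eq
  ... | inj₂ (μ , refl , refl) =
    castTm' ((δ ++ γ ++ μ) ++ Γt ++ ε') (δ ++ γ ++ μ ++ Γt ++ ε') (solve (++-monoid Type))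
      (lett (δ ++ γ ++ μ) ε'
        (castTm' (δ ++ γ ++ μ ++ as ++ ε') ((δ ++ γ ++ μ) ++ as ++ ε') (solve (++-monoid Type))
          (sub δ (μ ++ as ++ ε') e₁ s u)) t)
    where
      e₁ : (δ ++ a ∷ μ) ++ as ++ ε' ≡ δ ++ a ∷ μ ++ as ++ ε'
      e₁ = ++-assoc δ (a ∷ μ) (as ++ ε')
  ... | inj₁ (μ , refl , q) with split++ Γt ε' μ δ' a q
  ...   | inj₁ (ν , refl , refl) =
    castTm' (ε ++ Γt ++ ν ++ γ ++ δ') ((ε ++ Γt ++ ν) ++ γ ++ δ') (solve (++-monoid Type))
      (lett ε (ν ++ γ ++ δ')
        (castTm' ((ε ++ as ++ ν) ++ γ ++ δ') (ε ++ as ++ ν ++ γ ++ δ') (solve (++-monoid Type))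
          (sub (ε ++ as ++ ν) δ' e₂ s u))
        t)
    where
      e₂ : ε ++ as ++ ν ++ a ∷ δ' ≡ (ε ++ as ++ ν) ++ a ∷ δ'
      e₂ = solve (++-monoid Type)
  ...   | inj₂ (ν , refl , refl) =
    castTm' (ε ++ (μ ++ γ ++ ν) ++ ε') ((ε ++ μ) ++ γ ++ ν ++ ε') (solve (++-monoid Type))
      (lett ε ε' s (sub μ ν refl t u))

  subS [] δ' () []ₜ u
  subS (_ ∷ _) δ' () []ₜ u
  subS {γ = γ} {a = a} δ δ' eq (_∷ₜ_ {γ = Γs} {Γ = Γss} s ss) u
    with split++ Γs Γss δ δ' a eq
  ... | inj₂ (μ , refl , refl) =
    castTms (trans (++-assoc δ (γ ++ μ) Γss) (cong (δ ++_) (++-assoc γ μ Γss)))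
      (sub δ μ refl s u ∷ₜ ss)
  ... | inj₁ (μ , refl , refl) =
    castTms (sym (++-assoc Γs μ (γ ++ δ'))) (s ∷ₜ subS μ δ' refl ss u)

  -- Since the tᵢ have pairwise
  -- disjoint variables, it is computed by substituting one after another.

  subMany : ∀ {γ as b} (δ δ' : Ctx) → Tm (δ ++ as ++ δ') b → Tms γ as
            → Tm (δ ++ γ ++ δ') b
  subMany δ δ' s []ₜ = s
  subMany {b = b} δ δ' s (_∷ₜ_ {γ = γt} {Γ = Γ} {as = as} t ts) =
    castTm' ((δ ++ γt) ++ Γ ++ δ') (δ ++ (γt ++ Γ) ++ δ') (solve (++-monoid Type))
      (subMany (δ ++ γt) δ'
        (castTm' (δ ++ γt ++ as ++ δ') ((δ ++ γt) ++ as ++ δ') (solve (++-monoid Type))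
          (sub δ (as ++ δ') refl s t))
        ts)

  comp : ∀ {γ Γ a} → Tm γ a → Tms Γ γ → Tm Γ a
  comp {γ} {Γ} s ts =
    castTm (++-identityʳ Γ) (subMany [] [] (castTm (sym (++-identityʳ γ)) s) ts)

  comp1 : ∀ {γ a a'} → Tm [ a ] a' → Tm γ a → Tm γ a'
  comp1 {γ} h s = castTm (++-identityʳ γ) (comp h (s ∷ₜ []ₜ))

  data LCtx : Ctx → Ctx → Set where
    hole : ∀ {θ} → LCtx θ θ
    wrap : ∀ {θ γ as} (ε ε' : Ctx) → LCtx θ (ε ++ as ++ ε') → Tm γ (tensor as)
           → LCtx θ (ε ++ γ ++ ε')

  plugL : ∀ {θ θ' c} → LCtx θ θ' → Tm θ c → Tm θ' c
  plugL hole u = u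
  plugL (wrap ε ε' L t) u = lett ε ε' (plugL L u) t

  shiftL : ∀ {θ θ'} (δ δ' : Ctx) → LCtx θ θ' → LCtx (δ ++ θ ++ δ') (δ ++ θ' ++ δ')
  shiftL δ δ' hole = hole
  shiftL {θ} δ δ' (wrap {γ = γ} {as = as} ε ε' L t) =
    subst (LCtx (δ ++ θ ++ δ')) (eq₂ γ)
      (wrap (δ ++ ε) (ε' ++ δ')
        (subst (LCtx (δ ++ θ ++ δ')) (eq₁ as) (shiftL δ δ' L)) t)
    where
      eq₁ : ∀ x → δ ++ (ε ++ x ++ ε') ++ δ' ≡ (δ ++ ε) ++ x ++ ε' ++ δ'
      eq₁ x = solve (++-monoid Type)
      eq₂ : ∀ x → (δ ++ ε) ++ x ++ ε' ++ δ' ≡ δ ++ (ε ++ x ++ ε') ++ δ'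
      eq₂ x = solve (++-monoid Type)

  IsLT : ∀ {γ as} → Tm γ (tensor as) → Set
  IsLT {γ} {as} u =
    Σ Ctx λ θ → Σ (LCtx θ γ) λ L → Σ (Tms θ as) λ ss → plugL L (tup ss) ≡ u

  -- One-hole contexts C through which a block X of variables of the hole
  -- passes unbound:  FC δ δ' c ρ ρ' b  sends a hole filler in context
  -- δ,X,δ' of type c to a term in context ρ,X,ρ' of type b, for every X.
  -- (So C binds none of the variables in X.)

  data FC (δ δ' : Ctx) (c : Type) : Ctx → Ctx → Type → Set where
    fhole : FC δ δ' c δ δ' c
    ftup  : ∀ {γ₁ γ₂ as₁ as₂ ρ ρ' a} → Tms γ₁ as₁ → FC δ δ' c ρ ρ' a → Tms γ₂ as₂
            → FC δ δ' c (γ₁ ++ ρ) (ρ' ++ γ₂) (tensor (as₁ ++ a ∷ as₂))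
    fop   : ∀ {γ₁ γ₂ as₁ as₂ ρ ρ' a b} → Arr (as₁ ++ a ∷ as₂) b
            → Tms γ₁ as₁ → FC δ δ' c ρ ρ' a → Tms γ₂ as₂
            → FC δ δ' c (γ₁ ++ ρ) (ρ' ++ γ₂) b
    fletL : ∀ {γ as ρ' b} (ε μ : Ctx) → FC δ δ' c (ε ++ as ++ μ) ρ' b
            → Tm γ (tensor as) → FC δ δ' c (ε ++ γ ++ μ) ρ' b
    fletR : ∀ {γ as ρ b} (μ ε : Ctx) → FC δ δ' c ρ (μ ++ as ++ ε) b
            → Tm γ (tensor as) → FC δ δ' c ρ (μ ++ γ ++ ε) b
    farg  : ∀ {as ρ ρ' b} (ε ε' : Ctx) → Tm (ε ++ as ++ ε') b
            → FC δ δ' c ρ ρ' (tensor as) → FC δ δ' c (ε ++ ρ) (ρ' ++ ε') b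

  plugF : ∀ {δ δ' c ρ ρ' b} → FC δ δ' c ρ ρ' b → (X : Ctx)
          → Tm (δ ++ X ++ δ') c → Tm (ρ ++ X ++ ρ') b
  plugF fhole X u = u
  plugF (ftup {γ₁} {γ₂} {ρ = ρ} {ρ'} ts C us) X u =
    castTm' (γ₁ ++ (ρ ++ X ++ ρ') ++ γ₂) ((γ₁ ++ ρ) ++ X ++ ρ' ++ γ₂)
      (solve (++-monoid Type)) (tup (ts ++ₜ (plugF C X u ∷ₜ us)))
  plugF (fop {γ₁} {γ₂} {ρ = ρ} {ρ'} f ts C us) X u =
    castTm' (γ₁ ++ (ρ ++ X ++ ρ') ++ γ₂) ((γ₁ ++ ρ) ++ X ++ ρ' ++ γ₂)
      (solve (++-monoid Type)) (op f (ts ++ₜ (plugF C X u ∷ₜ us)))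
  plugF (fletL {γ} {as} {ρ'} ε μ C t) X u =
    castTm' (ε ++ γ ++ μ ++ X ++ ρ') ((ε ++ γ ++ μ) ++ X ++ ρ') (solve (++-monoid Type))
      (lett ε (μ ++ X ++ ρ')
        (castTm' ((ε ++ as ++ μ) ++ X ++ ρ') (ε ++ as ++ μ ++ X ++ ρ')
          (solve (++-monoid Type)) (plugF C X u)) t)
  plugF (fletR {γ} {as} {ρ} μ ε C t) X u =
    castTm' ((ρ ++ X ++ μ) ++ γ ++ ε) (ρ ++ X ++ μ ++ γ ++ ε) (solve (++-monoid Type))
      (lett (ρ ++ X ++ μ) ε
        (castTm' (ρ ++ X ++ μ ++ as ++ ε) ((ρ ++ X ++ μ) ++ as ++ ε)
          (solve (++-monoid Type)) (plugF C X u)) t)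
  plugF (farg {ρ = ρ} {ρ'} ε ε' s C) X u =
    castTm' (ε ++ (ρ ++ X ++ ρ') ++ ε') ((ε ++ ρ) ++ X ++ ρ' ++ ε')
      (solve (++-monoid Type)) (lett ε ε' s (plugF C X u))

  TmRel : Set₁
  TmRel = ∀ {γ a} → Tm γ a → Tm γ a → Set

  data Comp (R : TmRel) : TmRel
  data CompS (R : TmRel) : ∀ {γ as} → Tms γ as → Tms γ as → Set
  data Comp R where
    root : ∀ {γ a} {s t : Tm γ a} → R s t → Comp R s t
    tupC : ∀ {γ as} {ss ts : Tms γ as} → CompS R ss ts → Comp R (tup ss) (tup ts)
    opC  : ∀ {γ as b} (f : Arr as b) {ss ts : Tms γ as} → CompS R ss ts
           → Comp R (op f ss) (op f ts)
    letB : ∀ {γ as b} (δ δ' : Ctx) {s s' : Tm (δ ++ as ++ δ') b} {t : Tm γ (tensor as)}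
           → Comp R s s' → Comp R (lett δ δ' s t) (lett δ δ' s' t)
    letA : ∀ {γ as b} (δ δ' : Ctx) {s : Tm (δ ++ as ++ δ') b} {t t' : Tm γ (tensor as)}
           → Comp R t t' → Comp R (lett δ δ' s t) (lett δ δ' s t')
  data CompS R where
    here  : ∀ {γ Γ a as} {s s' : Tm γ a} {ss : Tms Γ as}
            → Comp R s s' → CompS R (s ∷ₜ ss) (s' ∷ₜ ss)
    there : ∀ {γ Γ a as} {s : Tm γ a} {ss ss' : Tms Γ as}
            → CompS R ss ss' → CompS R (s ∷ₜ ss) (s ∷ₜ ss')

  data EqCl (R : TmRel) : TmRel where
    inc    : ∀ {γ a} {s t : Tm γ a} → R s t → EqCl R s t
    rfl    : ∀ {γ a} {s : Tm γ a} → EqCl R s s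
    symm   : ∀ {γ a} {s t : Tm γ a} → EqCl R s t → EqCl R t s
    trans' : ∀ {γ a} {s t u : Tm γ a} → EqCl R s t → EqCl R t u → EqCl R s u

  data BetaRoot : TmRel where
    beta : ∀ {θ θ' as b} (δ δ' : Ctx) (s : Tm (δ ++ as ++ δ') b) (L : LCtx θ θ')
           (ts : Tms θ as)
           → BetaRoot (lett δ δ' s (plugL L (tup ts)))
                      (plugL (shiftL δ δ' L) (subMany δ δ' s ts))

  etaExp : ∀ {γ as} → Tm γ (tensor as) → Tm γ (tensor as)
  etaExp {γ} {as} s =
    castTm (++-identityʳ γ)
      (lett [] [] (castTm (sym (++-identityʳ as)) (tup (vars as))) s)

  data EtaRoot : TmRel where
    eta : ∀ {γ as} (s : Tm γ (tensor as)) → ¬ IsLT s → EtaRoot s (etaExp s)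

  -- closure of η under E-contexts; EtaN = closure under E-contexts E ≠ [·]
  data EtaE : TmRel
  data EtaN : TmRel
  data EtaS : ∀ {γ as} → Tms γ as → Tms γ as → Set
  data EtaE where
    atRoot : ∀ {γ a} {s t : Tm γ a} → EtaRoot s t → EtaE s t
    inside : ∀ {γ a} {s t : Tm γ a} → EtaN s t → EtaE s t
  data EtaN where
    tupN  : ∀ {γ as} {ss ts : Tms γ as} → EtaS ss ts → EtaN (tup ss) (tup ts)
    opN   : ∀ {γ as b} (f : Arr as b) {ss ts : Tms γ as} → EtaS ss ts
            → EtaN (op f ss) (op f ts)
    letBN : ∀ {γ as b} (δ δ' : Ctx) {s s' : Tm (δ ++ as ++ δ') b} {t : Tm γ (tensor as)}
            → EtaE s s' → EtaN (lett δ δ' s t) (lett δ δ' s' t)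
    letAN : ∀ {γ as b} (δ δ' : Ctx) {s : Tm (δ ++ as ++ δ') b} {t t' : Tm γ (tensor as)}
            → EtaN t t' → EtaN (lett δ δ' s t) (lett δ δ' s t')
  data EtaS where
    hereN  : ∀ {γ Γ a as} {s s' : Tm γ a} {ss : Tms Γ as}
             → EtaE s s' → EtaS (s ∷ₜ ss) (s' ∷ₜ ss)
    thereN : ∀ {γ Γ a as} {s : Tm γ a} {ss ss' : Tms Γ as}
             → EtaS ss ss' → EtaS (s ∷ₜ ss) (s ∷ₜ ss')

  _→rep_ : TmRel
  s →rep t = Comp BetaRoot s t ⊎ EtaE s t

  data StrRoot : TmRel where
    str : ∀ {δ δ' c ρ ρ' b as γt} (C : FC δ δ' c ρ ρ' b)
          (s : Tm (δ ++ as ++ δ') c) (t : Tm γt (tensor as))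
          → StrRoot (plugF C γt (lett δ δ' s t)) (lett ρ ρ' (plugF C as s) t)

  _≡str_ : TmRel
  _≡str_ = EqCl (Comp StrRoot)

  -- ∼ : the equivalence relation generated by ≡ and →rep;
  -- 𝓕(𝓡)(γ;a) is the setoid (Tm γ a , _∼_)
  _∼_ : TmRel
  _∼_ = EqCl (λ s t → s ≡str t ⊎ s →rep t)

  infix 4 _∼_ _≡str_ _→rep_

  Φ : (γ δ as : Ctx) {a : Type} → Tm (γ ++ tensor as ∷ δ) a → Tm (γ ++ as ++ δ) a
  Φ γ δ as s = sub γ δ refl s (tup (vars as))

-- Write X = (a₁ ⊗ ⋯ ⊗ aₖ) and ⟨x⃗⟩ = ⟨x₁,…,xₖ⟩. Up to one β-step, Φ s = s{⟨x⃗⟩/x} is the let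
-- s[x := ⟨x⃗⟩], so Φ respects ∼ because ∼ is a congruence for let bodies. Its inverse is
-- Ψ u = u[x⃗ := x]: β-expanding s to s[x := ⟨x⟩], η-expanding that x to ⟨x⃗⟩[x⃗ := x] and moving the
-- inner let outwards by two structural steps gives s ∼ Ψ (Φ s), and one structural step followed
-- by two β-steps gives Φ (Ψ u) ∼ u. (Multi)naturality holds even as an equality of terms: it is an
-- instance of the associativity and commutation laws of substitution, whose proofs make up most
-- of the development (terms are nameless and intrinsically typed, so these laws must track
-- positions in contexts that agree only propositionally).

module Submission where

open import Defs
open import Data.Empty using (⊥; ⊥-elim)
open import Data.List using (List; []; _∷_; _++_; [_])
open import Data.List.Properties
  using (++-assoc; ++-identityʳ; ++-identityʳ-unique; ++-conicalʳ; ++-cancelˡ; ∷-injectiveʳ; ++-monoid)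
open import Data.Product using (Σ; _×_; _,_)
open import Data.Sum using (inj₁; inj₂)
open import Data.Unit using (⊤; tt)
open import Relation.Nullary using (¬_)
open import Relation.Binary.PropositionalEquality using (_≡_; _≢_; refl; sym; trans; cong; subst)
open import Axiom.UniquenessOfIdentityProofs.WithK using (uip)
open import Tactic.MonoidSolver using (solve)

[]≢xs++y∷ys : ∀ {A : Set} (xs : List A) {y ys} → [] ≢ xs ++ y ∷ ys
[]≢xs++y∷ys xs eq with ++-conicalʳ xs _ (sym eq)
... | ()

xs≢xs++ys++z∷zs : ∀ {A : Set} (xs ys : List A) {z zs} → xs ≢ xs ++ ys ++ z ∷ zs
xs≢xs++ys++z∷zs xs ys eq = []≢xs++y∷ys ys (sym (++-identityʳ-unique xs eq))

++-∷-cancelˡ : ∀ {A : Set} (xs : List A) {y : A} {ys zs} → xs ++ y ∷ ys ≡ xs ++ y ∷ zs → ys ≡ zs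
++-∷-cancelˡ xs eq = ∷-injectiveʳ (++-cancelˡ xs _ _ eq)

module Representability (𝓡 : Signature) where
  open Signature 𝓡
  open Syntax 𝓡

  -- Reassociations of contexts, named after their bracketings (juxtaposition is _++_).
  xyzw≡[xyz]w : (x y z w : Ctx) → x ++ y ++ z ++ w ≡ (x ++ y ++ z) ++ w
  xyzw≡[xyz]w x y z w = solve (++-monoid Type)

  [xyz]w≡xyzw : (x y z w : Ctx) → (x ++ y ++ z) ++ w ≡ x ++ y ++ z ++ w
  [xyz]w≡xyzw x y z w = solve (++-monoid Type)

  [xy]zw≡x[yz]w : (x y z w : Ctx) → (x ++ y) ++ z ++ w ≡ x ++ (y ++ z) ++ w
  [xy]zw≡x[yz]w x y z w = solve (++-monoid Type)

  [xy]zwv≡x[yzw]v : (x y z w v : Ctx) → (x ++ y) ++ z ++ w ++ v ≡ x ++ (y ++ z ++ w) ++ v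
  [xy]zwv≡x[yzw]v x y z w v = solve (++-monoid Type)

  [xyz]wv≡xyzwv : (x y z w v : Ctx) → (x ++ y ++ z) ++ w ++ v ≡ x ++ y ++ z ++ w ++ v
  [xyz]wv≡xyzwv x y z w v = solve (++-monoid Type)

  [[xy]z]w≡xyzw : (x y z w : Ctx) → ((x ++ y) ++ z) ++ w ≡ x ++ y ++ z ++ w
  [[xy]z]w≡xyzw x y z w = solve (++-monoid Type)

  [[xyz]w]v≡x[yz]wv : (x y z w v : Ctx) → ((x ++ y ++ z) ++ w) ++ v ≡ x ++ (y ++ z) ++ w ++ v
  [[xyz]w]v≡x[yz]wv x y z w v = solve (++-monoid Type)

  [x[yz]w]v≡xyzwv : (x y z w v : Ctx) → (x ++ (y ++ z) ++ w) ++ v ≡ x ++ y ++ z ++ w ++ v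
  [x[yz]w]v≡xyzwv x y z w v = solve (++-monoid Type)

  xyzw≡[xy]zw : (x y z w : Ctx) → x ++ y ++ z ++ w ≡ (x ++ y) ++ z ++ w
  xyzw≡[xy]zw x y z w = solve (++-monoid Type)

  x[ycz]w≡[xy]czw : (x y : Ctx) (c : Type) (z w : Ctx) → x ++ (y ++ c ∷ z) ++ w ≡ (x ++ y) ++ c ∷ z ++ w
  x[ycz]w≡[xy]czw x y c z w = trans (cong (x ++_) (++-assoc y (c ∷ z) w))
      (sym (++-assoc x y (c ∷ z ++ w)))

  -- Equality of terms of one type in propositionally equal contexts. Unlike the standard
  -- library's heterogeneous equality it can be matched on, the context being an index.
  infix 4 _≅_ _≅ₛ_
  data _≅_ {Γ a} (t : Tm Γ a) : ∀ {Γ'} → Tm Γ' a → Set where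
    hrefl : t ≅ t

  data _≅ₛ_ {Γ as} (ts : Tms Γ as) : ∀ {Γ'} → Tms Γ' as → Set where
    hrefl : ts ≅ₛ ts

  ≅-sym : ∀ {Γ Γ' a} {t : Tm Γ a} {t' : Tm Γ' a} → t ≅ t' → t' ≅ t
  ≅-sym hrefl = hrefl

  ≅-trans : ∀ {Γ Γ' Γ'' a} {t : Tm Γ a} {t' : Tm Γ' a} {t'' : Tm Γ'' a} → t ≅ t' → t' ≅ t'' → t ≅ t''
  ≅-trans hrefl q = q

  ≅ₛ-sym : ∀ {Γ Γ' as} {ts : Tms Γ as} {ts' : Tms Γ' as} → ts ≅ₛ ts' → ts' ≅ₛ ts
  ≅ₛ-sym hrefl = hrefl

  ≅ₛ-trans : ∀ {Γ Γ' Γ'' as} {ts : Tms Γ as} {ts' : Tms Γ' as} {ts'' : Tms Γ'' as} →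
             ts ≅ₛ ts' → ts' ≅ₛ ts'' → ts ≅ₛ ts''
  ≅ₛ-trans hrefl q = q

  castˡ : ∀ {Γ Γ' Γ'' a} {p : Γ ≡ Γ'} {t : Tm Γ a} {t' : Tm Γ'' a} → t ≅ t' → castTm p t ≅ t'
  castˡ {p = refl} q = q

  castʳ : ∀ {Γ Γ' Γ'' a} {p : Γ ≡ Γ'} {t : Tm Γ a} {t' : Tm Γ'' a} → t' ≅ t → t' ≅ castTm p t
  castʳ {p = refl} q = q

  castₛˡ : ∀ {Γ Γ' Γ'' as} {p : Γ ≡ Γ'} {ts : Tms Γ as} {ts' : Tms Γ'' as} → ts ≅ₛ ts' →
      castTms p ts ≅ₛ ts'
  castₛˡ {p = refl} q = q

  tup-cong : ∀ {Γ₁ Γ₂ as} {ss₁ : Tms Γ₁ as} {ss₂ : Tms Γ₂ as} → ss₁ ≅ₛ ss₂ → tup ss₁ ≅ tup ss₂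
  tup-cong hrefl = hrefl

  op-cong : ∀ {Γ₁ Γ₂ as b} (f : Arr as b) {ss₁ : Tms Γ₁ as} {ss₂ : Tms Γ₂ as} → ss₁ ≅ₛ ss₂ →
      op f ss₁ ≅ op f ss₂
  op-cong f hrefl = hrefl

  ∷ₜ-cong : ∀ {γ₁ γ₂ Γ₁ Γ₂ a as} {s₁ : Tm γ₁ a} {s₂ : Tm γ₂ a} {ss₁ : Tms Γ₁ as} {ss₂ : Tms Γ₂ as} →
            s₁ ≅ s₂ → ss₁ ≅ₛ ss₂ → (s₁ ∷ₜ ss₁) ≅ₛ (s₂ ∷ₜ ss₂)
  ∷ₜ-cong hrefl hrefl = hrefl

  lett-cong : ∀ {γ₁ γ₂ as b} {ε₁ ε₁' ε₂ ε₂' : Ctx} {s₁ : Tm (ε₁ ++ as ++ ε₁') b} {s₂ : Tm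
      (ε₂ ++ as ++ ε₂') b}
              {t₁ : Tm γ₁ (tensor as)} {t₂ : Tm γ₂ (tensor as)} →
              ε₁ ≡ ε₂ → ε₁' ≡ ε₂' → s₁ ≅ s₂ → t₁ ≅ t₂ → lett ε₁ ε₁' s₁ t₁ ≅ lett ε₂ ε₂' s₂ t₂
  lett-cong refl refl hrefl hrefl = hrefl

  -- The position proofs carried by `sub` are irrelevant by UIP.
  sub-cong : ∀ {Δ₁ Δ₂ γ₁ γ₂ a b} {δ₁ δ₁' δ₂ δ₂' : Ctx}
             (e₁ : Δ₁ ≡ δ₁ ++ a ∷ δ₁') (e₂ : Δ₂ ≡ δ₂ ++ a ∷ δ₂')
             {s₁ : Tm Δ₁ b} {s₂ : Tm Δ₂ b} {u₁ : Tm γ₁ a} {u₂ : Tm γ₂ a} →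
             δ₁ ≡ δ₂ → δ₁' ≡ δ₂' → s₁ ≅ s₂ → u₁ ≅ u₂ → sub δ₁ δ₁' e₁ s₁ u₁ ≅ sub δ₂ δ₂' e₂ s₂ u₂
  sub-cong e₁ e₂ refl refl hrefl hrefl with uip e₁ e₂
  ... | refl = hrefl

  subS-cong : ∀ {Δ₁ Δ₂ γ₁ γ₂ a bs} {δ₁ δ₁' δ₂ δ₂' : Ctx}
              (e₁ : Δ₁ ≡ δ₁ ++ a ∷ δ₁') (e₂ : Δ₂ ≡ δ₂ ++ a ∷ δ₂')
              {ss₁ : Tms Δ₁ bs} {ss₂ : Tms Δ₂ bs} {u₁ : Tm γ₁ a} {u₂ : Tm γ₂ a} →
              δ₁ ≡ δ₂ → δ₁' ≡ δ₂' → ss₁ ≅ₛ ss₂ → u₁ ≅ u₂ → subS δ₁ δ₁' e₁ ss₁ u₁ ≅ₛ subS δ₂ δ₂' e₂ ss₂ u₂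
  subS-cong e₁ e₂ refl refl hrefl hrefl with uip e₁ e₂
  ... | refl = hrefl

  position-≅ : ∀ {Δ₁ Δ₂ a b} {δ δ' : Ctx} {s₁ : Tm Δ₁ b} {s₂ : Tm Δ₂ b} →
               s₁ ≅ s₂ → Δ₁ ≡ δ ++ a ∷ δ' → Δ₂ ≡ δ ++ a ∷ δ'
  position-≅ hrefl e = e

  position-≅ₛ : ∀ {Δ₁ Δ₂ a bs} {δ δ' : Ctx} {ss₁ : Tms Δ₁ bs} {ss₂ : Tms Δ₂ bs} →
                ss₁ ≅ₛ ss₂ → Δ₁ ≡ δ ++ a ∷ δ' → Δ₂ ≡ δ ++ a ∷ δ'
  position-≅ₛ hrefl e = e

  sub-congˡ : ∀ {Δ₁ Δ₂ γ a b} {δ δ' : Ctx} (e : Δ₁ ≡ δ ++ a ∷ δ')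
              {s₁ : Tm Δ₁ b} {s₂ : Tm Δ₂ b} {u : Tm γ a} (h : s₁ ≅ s₂) →
              sub δ δ' e s₁ u ≅ sub δ δ' (position-≅ h e) s₂ u
  sub-congˡ e h = sub-cong e (position-≅ h e) refl refl h hrefl

  subS-congˡ : ∀ {Δ₁ Δ₂ γ a bs} {δ δ' : Ctx} (e : Δ₁ ≡ δ ++ a ∷ δ') {ss₁ : Tms Δ₁ bs} {ss₂ : Tms Δ₂ bs}
               {u : Tm γ a} (h : ss₁ ≅ₛ ss₂) → subS δ δ' e ss₁ u ≅ₛ subS δ δ' (position-≅ₛ h e) ss₂ u
  subS-congˡ e h = subS-cong e (position-≅ₛ h e) refl refl h hrefl

  sub-resplit : ∀ {Δ γ a b} {δ δ' δ₂ δ₂' : Ctx} (e₁ : Δ ≡ δ ++ a ∷ δ') (e₂ : Δ ≡ δ₂ ++ a ∷ δ₂') →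
                δ ≡ δ₂ → δ' ≡ δ₂' → (s : Tm Δ b) (u : Tm γ a) → sub δ δ' e₁ s u ≅ sub δ₂ δ₂' e₂ s u
  sub-resplit e₁ e₂ pδ pδ' s u = sub-cong e₁ e₂ {s₁ = s} {u₁ = u} pδ pδ' hrefl hrefl

  subS-resplit : ∀ {Δ γ a bs} (δ δ' : Ctx) (e₁ e₂ : Δ ≡ δ ++ a ∷ δ') (ss : Tms Δ bs) (u : Tm γ a) →
                 subS δ δ' e₁ ss u ≅ₛ subS δ δ' e₂ ss u
  subS-resplit δ δ' e₁ e₂ ss u = subS-cong e₁ e₂ {ss₁ = ss} {u₁ = u} refl refl hrefl hrefl

  bodyˡ-position : ∀ {ε δ μ : Ctx} {a : Type} (as ε' : Ctx) → ε ≡ δ ++ a ∷ μ →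
                   ε ++ as ++ ε' ≡ δ ++ a ∷ μ ++ as ++ ε'
  bodyˡ-position {δ = δ} {μ} {a} as ε' refl = ++-assoc δ (a ∷ μ) (as ++ ε')

  bodyʳ-position : ∀ {ε' ν : Ctx} {a : Type} {δ' : Ctx} (ε as : Ctx) → ε' ≡ ν ++ a ∷ δ' →
                   ε ++ as ++ ε' ≡ (ε ++ as ++ ν) ++ a ∷ δ'
  bodyʳ-position {ν = ν} {a} {δ'} ε as refl = xyzw≡[xyz]w ε as ν (a ∷ δ')

  sub-lett-bodyˡ : ∀ {γ as Γt b a} (ε ε' δ δ' μ : Ctx) (s : Tm (ε ++ as ++ ε') b) (t : Tm Γt (tensor as))
    (u : Tm γ a) (e1 : ε ≡ δ ++ a ∷ μ) (eq : ε ++ Γt ++ ε' ≡ δ ++ a ∷ δ') →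
    sub δ δ' eq (lett ε ε' s t) u ≅
    lett (δ ++ γ ++ μ) ε' (castTm (xyzw≡[xyz]w δ γ μ (as ++ ε'))
        (sub δ (μ ++ as ++ ε') (bodyˡ-position as ε' e1) s u)) t
  sub-lett-bodyˡ {Γt = Γt} {a = a} ε ε' δ δ' μ s t u e1 eq with split++ ε (Γt ++ ε') δ δ' a eq
  ... | inj₁ (μ' , refl , _) = ⊥-elim (xs≢xs++ys++z∷zs ε μ' (trans e1 (++-assoc ε μ' _)))
  ... | inj₂ (μ' , refl , refl) with ++-∷-cancelˡ δ e1
  ...   | refl = castˡ (lett-cong refl refl (castˡ (castʳ (sub-resplit _ _ refl refl s u))) hrefl)

  sub-lett-arg : ∀ {γ as Γt b a} (ε ε' δ δ' μ ν : Ctx) (s : Tm (ε ++ as ++ ε') b) (t : Tm Γt (tensor as))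
    (u : Tm γ a) (e1 : δ ≡ ε ++ μ) (e3 : Γt ≡ μ ++ a ∷ ν) (eq : ε ++ Γt ++ ε' ≡ δ ++ a ∷ δ') →
    sub δ δ' eq (lett ε ε' s t) u ≅ lett ε ε' s (sub μ ν e3 t u)
  sub-lett-arg {Γt = Γt} {a = a} ε ε' δ δ' μ ν s t u e1 e3 eq with split++ ε (Γt ++ ε') δ δ' a eq
  ... | inj₂ (μ' , refl , refl) = ⊥-elim (xs≢xs++ys++z∷zs δ [] (trans e1 (++-assoc δ (a ∷ μ') μ)))
  ... | inj₁ (μ' , refl , q) with split++ Γt ε' μ' δ' a q
  ...   | inj₁ (ν' , refl , refl) =
    ⊥-elim (xs≢xs++ys++z∷zs Γt ν'
        (trans e3 (trans (cong (_++ _) (++-cancelˡ ε _ _ (sym e1))) (++-assoc Γt ν' _))))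
  ...   | inj₂ (ν' , refl , refl) with ++-cancelˡ ε _ _ e1
  ...     | refl with ++-∷-cancelˡ μ e3
  ...       | refl = castˡ (lett-cong refl refl hrefl (sub-resplit _ e3 refl refl t u))

  sub-lett-bodyʳ : ∀ {γ as Γt b a} (ε ε' δ δ' ν : Ctx) (s : Tm (ε ++ as ++ ε') b) (t : Tm Γt (tensor as))
    (u : Tm γ a) (e1 : δ ≡ ε ++ Γt ++ ν) (e2 : ε' ≡ ν ++ a ∷ δ') (eq : ε ++ Γt ++ ε' ≡ δ ++ a ∷ δ') →
    sub δ δ' eq (lett ε ε' s t) u ≅
    lett ε (ν ++ γ ++ δ') (castTm (sym (xyzw≡[xyz]w ε as ν (γ ++ δ')))
        (sub (ε ++ as ++ ν) δ' (bodyʳ-position ε as e2) s u)) t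
  sub-lett-bodyʳ {Γt = Γt} {a = a} ε ε' δ δ' ν s t u e1 e2 eq with split++ ε (Γt ++ ε') δ δ' a eq
  ... | inj₂ (μ' , refl , refl) = ⊥-elim (xs≢xs++ys++z∷zs δ [] (trans e1 (++-assoc δ (a ∷ μ') _)))
  ... | inj₁ (μ' , refl , q) with split++ Γt ε' μ' δ' a q
  ...   | inj₂ (ν' , refl , refl) = ⊥-elim (xs≢xs++ys++z∷zs μ' []
      (trans (++-cancelˡ ε _ _ e1) (++-assoc μ' (a ∷ ν') _)))
  ...   | inj₁ (ν' , refl , refl) with ++-cancelˡ Γt _ _ (++-cancelˡ ε _ _ e1)
  ...     | refl = castˡ (lett-cong refl refl (castˡ (castʳ (sub-resplit _ _ refl refl s u))) hrefl)

  subS-head : ∀ {γ a Γs Γss c cs} (δ δ' μ : Ctx) (s : Tm Γs c) (ss : Tms Γss cs) (u : Tm γ a)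
    (e1 : Γs ≡ δ ++ a ∷ μ) (eq : Γs ++ Γss ≡ δ ++ a ∷ δ') →
        subS δ δ' eq (s ∷ₜ ss) u ≅ₛ (sub δ μ e1 s u ∷ₜ ss)
  subS-head {a = a} {Γs} {Γss} [] δ' μ s ss u e1 eq with split++ Γs Γss [] δ' a eq
  ... | inj₁ (μ' , p , q) = ⊥-elim ([]≢xs++y∷ys [] (trans p (cong (_++ μ') e1)))
  ... | inj₂ (μ' , refl , refl) with ++-∷-cancelˡ [] e1
  ...   | refl = castₛˡ (∷ₜ-cong (sub-resplit _ _ refl refl s u) hrefl)
  subS-head {a = a} {Γs} {Γss} (x ∷ δ) δ' μ s ss u e1 eq with split++ Γs Γss (x ∷ δ) δ' a eq
  ... | inj₁ (μ' , p , q) =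
    ⊥-elim (xs≢xs++ys++z∷zs (x ∷ δ) []
        (trans p (trans (cong (_++ μ') e1) (++-assoc (x ∷ δ) (a ∷ μ) μ'))))
  ... | inj₂ (μ' , refl , refl) with ++-∷-cancelˡ (x ∷ δ) e1
  ...   | refl = castₛˡ (∷ₜ-cong (sub-resplit _ _ refl refl s u) hrefl)

  subS-tail : ∀ {γ a Γs Γss c cs} (δ δ' μ : Ctx) (s : Tm Γs c) (ss : Tms Γss cs) (u : Tm γ a)
    (e1 : δ ≡ Γs ++ μ) (e2 : Γss ≡ μ ++ a ∷ δ') (eq : Γs ++ Γss ≡ δ ++ a ∷ δ') →
    subS δ δ' eq (s ∷ₜ ss) u ≅ₛ (s ∷ₜ subS μ δ' e2 ss u)
  subS-tail {Γs = _ ∷ _} [] δ' μ s ss u () e2 eq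
  subS-tail {a = a} {Γs = []} {Γss} [] δ' μ s ss u refl e2 eq with split++ [] Γss [] δ' a eq
  ... | inj₁ (μ' , refl , refl) = castₛˡ (∷ₜ-cong hrefl (subS-resplit μ δ' _ e2 ss u))
  subS-tail {a = a} {Γs = []} {Γss} (x ∷ δ) δ' μ s ss u e1 e2 eq with split++ [] Γss (x ∷ δ) δ' a eq
  ... | inj₁ (μ' , refl , refl) with e1
  ...   | refl = castₛˡ (∷ₜ-cong hrefl (subS-resplit μ δ' _ e2 ss u))
  subS-tail {a = a} {Γs = y ∷ Γs} {Γss} (x ∷ δ) δ' μ s ss u e1 e2 eq with split++ (y ∷ Γs) Γss (x ∷ δ) δ' a eq
  ... | inj₂ (μ' , refl , refl) = ⊥-elim (xs≢xs++ys++z∷zs (x ∷ δ) []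
      (trans e1 (++-assoc (x ∷ δ) (a ∷ μ') _)))
  ... | inj₁ (μ' , refl , refl) with ++-cancelˡ (y ∷ Γs) _ _ e1
  ...   | refl = castₛˡ (∷ₜ-cong hrefl (subS-resplit μ δ' _ e2 ss u))

  sub-var : ∀ {γ a} (u : Tm γ a) (eq : [ a ] ≡ [] ++ a ∷ []) → sub [] [] eq var u ≅ u
  sub-var u refl = castˡ hrefl

  data LettPosition (ε Γt ε' δ : Ctx) (a : Type) (δ' : Ctx) : Set where
    in-bodyˡ : (μ : Ctx) → ε ≡ δ ++ a ∷ μ → δ' ≡ μ ++ Γt ++ ε' → LettPosition ε Γt ε' δ a δ'
    in-arg   : (μ ν : Ctx) → δ ≡ ε ++ μ → Γt ≡ μ ++ a ∷ ν → δ' ≡ ν ++ ε' → LettPosition ε Γt ε' δ a δ'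
    in-bodyʳ : (ν : Ctx) → δ ≡ ε ++ Γt ++ ν → ε' ≡ ν ++ a ∷ δ' → LettPosition ε Γt ε' δ a δ'

  lett-position : ∀ ε Γt ε' δ a δ' → ε ++ Γt ++ ε' ≡ δ ++ a ∷ δ' → LettPosition ε Γt ε' δ a δ'
  lett-position ε Γt ε' δ a δ' eq with split++ ε (Γt ++ ε') δ δ' a eq
  ... | inj₂ (μ , p , q) = in-bodyˡ μ p q
  ... | inj₁ (μ , p , q) with split++ Γt ε' μ δ' a q
  ...   | inj₁ (ν , p' , q') = in-bodyʳ ν (trans p (cong (ε ++_) p')) q'
  ...   | inj₂ (ν , p' , q') = in-arg μ ν p p' q'

  data ConsPosition (Γs Γss δ : Ctx) (a : Type) (δ' : Ctx) : Set where
    in-head : (μ : Ctx) → Γs ≡ δ ++ a ∷ μ → δ' ≡ μ ++ Γss → ConsPosition Γs Γss δ a δ'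
    in-tail : (μ : Ctx) → δ ≡ Γs ++ μ → Γss ≡ μ ++ a ∷ δ' → ConsPosition Γs Γss δ a δ'

  cons-position : ∀ Γs Γss δ a δ' → Γs ++ Γss ≡ δ ++ a ∷ δ' → ConsPosition Γs Γss δ a δ'
  cons-position Γs Γss δ a δ' eq with split++ Γs Γss δ δ' a eq
  ... | inj₂ (μ , p , q) = in-head μ p q
  ... | inj₁ (μ , p , q) = in-tail μ p q

  sub-identity : ∀ {Δ a b} δ δ' (eq : Δ ≡ δ ++ a ∷ δ') (s : Tm Δ b) → sub δ δ' eq s (var {a = a}) ≅ s
  subS-identity : ∀ {Δ a bs} δ δ' (eq : Δ ≡ δ ++ a ∷ δ') (ss : Tms Δ bs) →
      subS δ δ' eq ss (var {a = a}) ≅ₛ ss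
  sub-identity [] δ' eq var = sub-var-by-var eq
    where
      sub-var-by-var : ∀ {a b δ'} (eq : [ b ] ≡ a ∷ δ') → sub [] δ' eq var var ≅ var
      sub-var-by-var refl = sub-var var refl
  sub-identity (_ ∷ δ) δ' eq var = ⊥-elim ([]≢xs++y∷ys δ (∷-injectiveʳ eq))
  sub-identity δ δ' eq (tup ts) = tup-cong (subS-identity δ δ' eq ts)
  sub-identity δ δ' eq (op f ts) = op-cong f (subS-identity δ δ' eq ts)
  sub-identity {a = a} δ δ' eq (lett {γ = Γt} ε ε' s t) with lett-position ε Γt ε' δ a δ' eq
  ... | in-bodyˡ μ refl refl =
    ≅-trans (sub-lett-bodyˡ ε ε' δ _ μ s t var refl eq)
            (lett-cong refl refl (castˡ (sub-identity δ _ _ s)) hrefl)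
  ... | in-arg μ ν refl refl refl =
    ≅-trans (sub-lett-arg ε ε' _ _ μ ν s t var refl refl eq)
            (lett-cong refl refl hrefl (sub-identity μ ν refl t))
  ... | in-bodyʳ ν refl refl =
    ≅-trans (sub-lett-bodyʳ ε ε' _ δ' ν s t var refl refl eq)
            (lett-cong refl refl (castˡ (sub-identity _ δ' _ s)) hrefl)
  subS-identity δ δ' eq []ₜ = ⊥-elim ([]≢xs++y∷ys δ eq)
  subS-identity {a = a} δ δ' eq (_∷ₜ_ {γ = Γs} {Γ = Γss} s ss) with cons-position Γs Γss δ a δ' eq
  ... | in-head μ refl refl =
    ≅ₛ-trans (subS-head δ _ μ s ss var refl eq) (∷ₜ-cong (sub-identity δ μ refl s) hrefl)
  ... | in-tail μ refl refl =
    ≅ₛ-trans (subS-tail _ δ' μ s ss var refl refl eq) (∷ₜ-cong hrefl (subS-identity μ δ' refl ss))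

  sub-assoc : ∀ {Δ c b a' Θ} (ε ε' δ0 δ0' : Ctx) (eq0 : Δ ≡ ε ++ c ∷ ε') (h : Tm Δ b)
    (w : Tm (δ0 ++ a' ∷ δ0') c) (u : Tm Θ a')
    (e : ε ++ (δ0 ++ a' ∷ δ0') ++ ε' ≡ (ε ++ δ0) ++ a' ∷ δ0' ++ ε') →
    sub (ε ++ δ0) (δ0' ++ ε') e (sub ε ε' eq0 h w) u ≅ sub ε ε' eq0 h (sub δ0 δ0' refl w u)
  subS-assoc : ∀ {Δ c bs a' Θ} (ε ε' δ0 δ0' : Ctx) (eq0 : Δ ≡ ε ++ c ∷ ε') (h : Tms Δ bs)
    (w : Tm (δ0 ++ a' ∷ δ0') c) (u : Tm Θ a')
    (e : ε ++ (δ0 ++ a' ∷ δ0') ++ ε' ≡ (ε ++ δ0) ++ a' ∷ δ0' ++ ε') →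
    subS (ε ++ δ0) (δ0' ++ ε') e (subS ε ε' eq0 h w) u ≅ₛ subS ε ε' eq0 h (sub δ0 δ0' refl w u)
  sub-assoc [] ε' δ0 δ0' eq0 var w u e = sub-var-assoc eq0 e
    where
      sub-var-assoc : ∀ {b c a' Θ ε' δ0 δ0'} {w : Tm (δ0 ++ a' ∷ δ0') c} {u : Tm Θ a'}
        (eq0 : [ b ] ≡ c ∷ ε') (e : (δ0 ++ a' ∷ δ0') ++ ε' ≡ δ0 ++ a' ∷ δ0' ++ ε') →
        sub δ0 (δ0' ++ ε') e (sub [] ε' eq0 var w) u ≅ sub [] ε' eq0 var (sub δ0 δ0' refl w u)
      sub-var-assoc {δ0' = δ0'} {w = w} refl e =
        ≅-trans (sub-cong e refl refl (++-identityʳ δ0') (sub-var w refl) hrefl) (≅-sym (sub-var _ refl))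
  sub-assoc (x ∷ ε) ε' δ0 δ0' eq0 var w u e = ⊥-elim ([]≢xs++y∷ys ε (∷-injectiveʳ eq0))
  sub-assoc ε ε' δ0 δ0' eq0 (tup ts) w u e = tup-cong (subS-assoc ε ε' δ0 δ0' eq0 ts w u e)
  sub-assoc ε ε' δ0 δ0' eq0 (op f ts) w u e = op-cong f (subS-assoc ε ε' δ0 δ0' eq0 ts w u e)
  sub-assoc {c = c} {a' = a'} {Θ = Θ} ε ε' δ0 δ0' eq0 (lett {γ = Γt} {as = as} ε₁ ε₁' s t) w u e
    with lett-position ε₁ Γt ε₁' ε c ε' eq0
  ... | in-bodyˡ μ refl refl =
    let W = δ0 ++ a' ∷ δ0'
        inner₁ = sub-lett-bodyˡ ε₁ ε₁' ε _ μ s t w refl eq0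
        lhs≅ = ≅-trans (sub-congˡ e inner₁)
                 (sub-lett-bodyˡ (ε ++ W ++ μ) ε₁' (ε ++ δ0) (δ0' ++ ε') (δ0' ++ μ) _ t u
                   (x[ycz]w≡[xy]czw ε δ0 a' δ0' μ) _)
        rhs≅ = sub-lett-bodyˡ ε₁ ε₁' ε _ μ s t (sub δ0 δ0' refl w u) refl eq0
        body≅ = ≅-trans
                  (sub-cong _ (x[ycz]w≡[xy]czw ε δ0 a' δ0' (μ ++ as ++ ε₁')) refl (++-assoc δ0' μ _)
                    (castˡ {p = xyzw≡[xyz]w ε W μ (as ++ ε₁')} hrefl) hrefl)
                  (sub-assoc ε (μ ++ as ++ ε₁') δ0 δ0' _ s w u _)
    in ≅-trans lhs≅
         (≅-trans (lett-cong ([xy]zwv≡x[yzw]v ε δ0 Θ δ0' μ) refl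
                    (castˡ {p = xyzw≡[xyz]w (ε ++ δ0) Θ (δ0' ++ μ) (as ++ ε₁')}
                      (≅-trans body≅
                        (≅-sym (castˡ {p = xyzw≡[xyz]w ε (δ0 ++ Θ ++ δ0') μ (as ++ ε₁')} hrefl))))
                    hrefl)
                  (≅-sym rhs≅))
  ... | in-arg μ ν refl refl refl =
    let inner₁ = sub-lett-arg ε₁ ε₁' (ε₁ ++ μ) _ μ ν s t w refl refl eq0
        lhs≅ = ≅-trans (sub-congˡ e inner₁)
                 (sub-lett-arg ε₁ ε₁' ((ε₁ ++ μ) ++ δ0) (δ0' ++ ν ++ ε₁') (μ ++ δ0) (δ0' ++ ν) s _ u
                   (++-assoc ε₁ μ δ0) (x[ycz]w≡[xy]czw μ δ0 a' δ0' ν) _)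
        rhs≅ = sub-lett-arg ε₁ ε₁' (ε₁ ++ μ) _ μ ν s t (sub δ0 δ0' refl w u) refl refl eq0
    in ≅-trans lhs≅
         (≅-trans (lett-cong refl refl hrefl (sub-assoc μ ν δ0 δ0' refl t w u _)) (≅-sym rhs≅))
  ... | in-bodyʳ ν refl refl =
    let W = δ0 ++ a' ∷ δ0'
        inner₁ = sub-lett-bodyʳ ε₁ ε₁' _ ε' ν s t w refl refl eq0
        lhs≅ = ≅-trans (sub-congˡ e inner₁)
                 (sub-lett-bodyʳ ε₁ (ν ++ W ++ ε') ((ε₁ ++ Γt ++ ν) ++ δ0) (δ0' ++ ε') (ν ++ δ0) _ t u
                   ([xyz]w≡xyzw ε₁ Γt ν δ0) (x[ycz]w≡[xy]czw ν δ0 a' δ0' ε') _)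
        rhs≅ = sub-lett-bodyʳ ε₁ ε₁' _ ε' ν s t (sub δ0 δ0' refl w u) refl refl eq0
        body≅ = ≅-trans
                  (sub-cong _ (x[ycz]w≡[xy]czw (ε₁ ++ as ++ ν) δ0 a' δ0' ε') (xyzw≡[xyz]w ε₁ as ν δ0) refl
                    (castˡ {p = sym (xyzw≡[xyz]w ε₁ as ν (W ++ ε'))} hrefl) hrefl)
                  (sub-assoc (ε₁ ++ as ++ ν) ε' δ0 δ0' _ s w u _)
    in ≅-trans lhs≅
         (≅-trans (lett-cong refl ([xy]zwv≡x[yzw]v ν δ0 Θ δ0' ε')
                    (castˡ {p = sym (xyzw≡[xyz]w ε₁ as (ν ++ δ0) (Θ ++ δ0' ++ ε'))}
                      (≅-trans body≅
                        (≅-sym (castˡ {p = sym (xyzw≡[xyz]w ε₁ as ν ((δ0 ++ Θ ++ δ0') ++ ε'))} hrefl))))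
                    hrefl)
                  (≅-sym rhs≅))
  subS-assoc ε ε' δ0 δ0' eq0 []ₜ w u e = ⊥-elim ([]≢xs++y∷ys ε eq0)
  subS-assoc {c = c} {a' = a'} ε ε' δ0 δ0' eq0 (_∷ₜ_ {γ = Γs} {Γ = Γss} s ss) w u e
    with cons-position Γs Γss ε c ε' eq0
  ... | in-head μ refl refl =
    let inner₁ = subS-head ε _ μ s ss w refl eq0
        lhs≅ = ≅ₛ-trans (subS-congˡ e inner₁)
               (subS-head (ε ++ δ0) (δ0' ++ μ ++ Γss) (δ0' ++ μ) _ ss u
                   (x[ycz]w≡[xy]czw ε δ0 a' δ0' μ) _)
        rhs≅ = subS-head ε _ μ s ss (sub δ0 δ0' refl w u) refl eq0
    in ≅ₛ-trans lhs≅ (≅ₛ-trans (∷ₜ-cong (sub-assoc ε μ δ0 δ0' refl s w u _) hrefl) (≅ₛ-sym rhs≅))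
  ... | in-tail μ refl refl =
    let inner₁ = subS-tail _ ε' μ s ss w refl refl eq0
        lhs≅ = ≅ₛ-trans (subS-congˡ e inner₁)
               (subS-tail ((Γs ++ μ) ++ δ0) (δ0' ++ ε') (μ ++ δ0) s _ u (++-assoc Γs μ δ0)
                   (x[ycz]w≡[xy]czw μ δ0 a' δ0' ε') _)
        rhs≅ = subS-tail _ ε' μ s ss (sub δ0 δ0' refl w u) refl refl eq0
    in ≅ₛ-trans lhs≅ (≅ₛ-trans (∷ₜ-cong hrefl (subS-assoc μ ε' δ0 δ0' refl ss w u _)) (≅ₛ-sym rhs≅))

  second-position : ∀ {Δ} (δ1 : Ctx) (a1 : Type) (δ2 : Ctx) (a2 : Type) (δ3 : Ctx) →
                    Δ ≡ δ1 ++ a1 ∷ δ2 ++ a2 ∷ δ3 → Δ ≡ (δ1 ++ a1 ∷ δ2) ++ a2 ∷ δ3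
  second-position δ1 a1 δ2 a2 δ3 e1 = trans e1 (sym (++-assoc δ1 (a1 ∷ δ2) (a2 ∷ δ3)))

  -- In a let, each of the two variables lies in the left part of the body, in the argument, or in
  -- the right part of the body; as the first precedes the second, six of the nine cases occur.
  sub-comm : ∀ {Δ b a1 a2 Θ1 Θ2} (δ1 δ2 δ3 : Ctx) (s : Tm Δ b) (u1 : Tm Θ1 a1) (u2 : Tm Θ2 a2)
    (e1 : Δ ≡ δ1 ++ a1 ∷ δ2 ++ a2 ∷ δ3) →
    sub (δ1 ++ Θ1 ++ δ2) δ3 (xyzw≡[xyz]w δ1 Θ1 δ2 (a2 ∷ δ3)) (sub δ1 (δ2 ++ a2 ∷ δ3) e1 s u1) u2
    ≅ sub δ1 (δ2 ++ Θ2 ++ δ3) (++-assoc δ1 (a1 ∷ δ2) (Θ2 ++ δ3)) (sub (δ1 ++ a1 ∷ δ2) δ3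
        (second-position δ1 a1 δ2 a2 δ3 e1) s u2) u1
  subS-comm : ∀ {Δ bs a1 a2 Θ1 Θ2} (δ1 δ2 δ3 : Ctx) (s : Tms Δ bs) (u1 : Tm Θ1 a1) (u2 : Tm Θ2 a2)
    (e1 : Δ ≡ δ1 ++ a1 ∷ δ2 ++ a2 ∷ δ3) →
    subS (δ1 ++ Θ1 ++ δ2) δ3 (xyzw≡[xyz]w δ1 Θ1 δ2 (a2 ∷ δ3)) (subS δ1 (δ2 ++ a2 ∷ δ3) e1 s u1) u2
    ≅ₛ subS δ1 (δ2 ++ Θ2 ++ δ3) (++-assoc δ1 (a1 ∷ δ2) (Θ2 ++ δ3)) (subS (δ1 ++ a1 ∷ δ2) δ3
        (second-position δ1 a1 δ2 a2 δ3 e1) s u2) u1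
  sub-comm [] δ2 δ3 var u1 u2 e1 = ⊥-elim ([]≢xs++y∷ys δ2 (∷-injectiveʳ e1))
  sub-comm (x ∷ δ1) δ2 δ3 var u1 u2 e1 = ⊥-elim ([]≢xs++y∷ys δ1 (∷-injectiveʳ e1))
  sub-comm δ1 δ2 δ3 (tup ts) u1 u2 e1 = tup-cong (subS-comm δ1 δ2 δ3 ts u1 u2 e1)
  sub-comm δ1 δ2 δ3 (op f ts) u1 u2 e1 = op-cong f (subS-comm δ1 δ2 δ3 ts u1 u2 e1)
  sub-comm {a1 = a1} {a2 = a2} δ1 δ2 δ3 (lett {γ = Γt} ε ε' s t) u1 u2 e1
    with lett-position ε Γt ε' δ1 a1 (δ2 ++ a2 ∷ δ3) e1
       | lett-position ε Γt ε' (δ1 ++ a1 ∷ δ2) a2 δ3 (second-position δ1 a1 δ2 a2 δ3 e1)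
  sub-comm {a1 = a1} {a2 = a2} δ1 δ2 δ3 (lett ε ε' s t) u1 u2 e1
    | in-arg μ1 ν1 refl r1 q1 | in-bodyˡ μ2 p2 q2 =
    ⊥-elim (xs≢xs++ys++z∷zs ε μ1 (trans p2 ([[xy]z]w≡xyzw ε μ1 (a1 ∷ δ2) (a2 ∷ μ2))))
  sub-comm {a1 = a1} {a2 = a2} δ1 δ2 δ3 (lett {γ = Γt} ε ε' s t) u1 u2 e1
    | in-bodyʳ ν1 refl q1 | in-bodyˡ μ2 p2 q2 =
    ⊥-elim (xs≢xs++ys++z∷zs ε (Γt ++ ν1) (trans p2 ([[xyz]w]v≡x[yz]wv ε Γt ν1 (a1 ∷ δ2) (a2 ∷ μ2))))
  sub-comm {a1 = a1} {a2 = a2} δ1 δ2 δ3 (lett ε ε' s t) u1 u2 e1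
    | in-bodyʳ ν1 refl q1 | in-arg μ2 ν2 p2 refl q2 =
    ⊥-elim (xs≢xs++ys++z∷zs μ2 []
        (++-cancelˡ ε _ _ (trans (sym p2) ([x[yz]w]v≡xyzwv ε μ2 (a2 ∷ ν2) ν1 (a1 ∷ δ2)))))
  sub-comm {a1 = a1} {a2 = a2} {Θ1 = Θ1} {Θ2 = Θ2} δ1 δ2 δ3 (lett {as = as} ε ε' s t) u1 u2 e1
    | in-bodyˡ μ1 refl q1 | in-bodyˡ μ2 p2 refl
      with ++-∷-cancelˡ δ1 (trans p2 (++-assoc δ1 (a1 ∷ δ2) (a2 ∷ μ2)))
  ...   | refl =
    let inner₁ = sub-lett-bodyˡ ε ε' δ1 _ μ1 s t u1 refl e1
        lhs≅ = ≅-trans (sub-congˡ (xyzw≡[xyz]w δ1 Θ1 δ2 (a2 ∷ δ3)) inner₁)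
               (sub-lett-bodyˡ (δ1 ++ Θ1 ++ μ1) ε' (δ1 ++ Θ1 ++ δ2) δ3 μ2 _ t u2
                   (xyzw≡[xyz]w δ1 Θ1 δ2 (a2 ∷ μ2)) _)
        inner₂ = sub-lett-bodyˡ ε ε' (δ1 ++ a1 ∷ δ2) δ3 μ2 s t u2
            (sym (++-assoc δ1 (a1 ∷ δ2) (a2 ∷ μ2))) (second-position δ1 a1 δ2 a2 δ3 e1)
        rhs≅ = ≅-trans (sub-congˡ (++-assoc δ1 (a1 ∷ δ2) (Θ2 ++ δ3)) inner₂)
               (sub-lett-bodyˡ ((δ1 ++ a1 ∷ δ2) ++ Θ2 ++ μ2) ε' δ1 (δ2 ++ Θ2 ++ δ3)
                   (δ2 ++ Θ2 ++ μ2) _ t u1 (++-assoc δ1 (a1 ∷ δ2) (Θ2 ++ μ2)) _)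
        e1' = trans (bodyˡ-position as ε' refl)
            (cong (λ z → δ1 ++ a1 ∷ z) (++-assoc δ2 (a2 ∷ μ2) (as ++ ε')))
        ih = sub-comm δ1 δ2 (μ2 ++ as ++ ε') s u1 u2 e1'
        body≅ = castˡ {p = xyzw≡[xyz]w (δ1 ++ Θ1 ++ δ2) Θ2 μ2 (as ++ ε')}
               (≅-trans (sub-cong _ (xyzw≡[xyz]w δ1 Θ1 δ2 (a2 ∷ μ2 ++ as ++ ε')) refl refl
                          (castˡ {p = xyzw≡[xyz]w δ1 Θ1 μ1 (as ++ ε')}
                              (sub-resplit _ e1' refl (++-assoc δ2 (a2 ∷ μ2) (as ++ ε')) s u1)) hrefl)
               (≅-trans ih (≅-sym (castˡ {p = xyzw≡[xyz]w δ1 Θ1 (δ2 ++ Θ2 ++ μ2) (as ++ ε')}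
                   (sub-cong _ (++-assoc δ1 (a1 ∷ δ2) (Θ2 ++ μ2 ++ as ++ ε')) refl
                       ([xyz]w≡xyzw δ2 Θ2 μ2 (as ++ ε'))
                      (castˡ {p = xyzw≡[xyz]w (δ1 ++ a1 ∷ δ2) Θ2 μ2 (as ++ ε')}
                          (sub-resplit _
                          (second-position δ1 a1 δ2 a2 (μ2 ++ as ++ ε') e1') refl refl s u2)) hrefl)))))
    in ≅-trans lhs≅ (≅-trans (lett-cong ([xyz]w≡xyzw δ1 Θ1 δ2 (Θ2 ++ μ2)) refl body≅ hrefl) (≅-sym rhs≅))
  sub-comm {a1 = a1} {a2 = a2} {Θ1 = Θ1} {Θ2 = Θ2} δ1 δ2 δ3 (lett ε ε' s t) u1 u2 e1
    | in-bodyˡ μ1 refl q1 | in-arg μ2 ν2 p2 refl refl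
      with ++-∷-cancelˡ δ1 (trans p2 (++-assoc δ1 (a1 ∷ μ1) μ2))
  ...   | refl =
    let inner₁ = sub-lett-bodyˡ ε ε' δ1 _ μ1 s t u1 refl e1
        lhs≅ = ≅-trans (sub-congˡ (xyzw≡[xyz]w δ1 Θ1 δ2 (a2 ∷ δ3)) inner₁)
               (sub-lett-arg (δ1 ++ Θ1 ++ μ1) ε' (δ1 ++ Θ1 ++ μ1 ++ μ2) δ3 μ2 ν2 _ t u2
                   (xyzw≡[xyz]w δ1 Θ1 μ1 μ2) refl _)
        inner₂ = sub-lett-arg ε ε' (δ1 ++ a1 ∷ μ1 ++ μ2) δ3 μ2 ν2 s t u2
            (sym (++-assoc δ1 (a1 ∷ μ1) μ2)) refl (second-position δ1 a1 δ2 a2 δ3 e1)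
        rhs≅ = ≅-trans (sub-congˡ (++-assoc δ1 (a1 ∷ δ2) (Θ2 ++ δ3)) inner₂)
               (sub-lett-bodyˡ ε ε' δ1 (δ2 ++ Θ2 ++ δ3) μ1 s _ u1 refl _)
    in ≅-trans lhs≅ (≅-sym rhs≅)
  sub-comm {a1 = a1} {a2 = a2} {Θ1 = Θ1} {Θ2 = Θ2} δ1 δ2 δ3 (lett {γ = Γt} {as = as} ε ε' s t) u1 u2 e1
    | in-bodyˡ μ1 refl q1 | in-bodyʳ ν2 p2 refl
      with ++-∷-cancelˡ δ1 (trans p2 (++-assoc δ1 (a1 ∷ μ1) (Γt ++ ν2)))
  ...   | refl =
    let inner₁ = sub-lett-bodyˡ ε ε' δ1 _ μ1 s t u1 refl e1
        lhs≅ = ≅-trans (sub-congˡ (xyzw≡[xyz]w δ1 Θ1 δ2 (a2 ∷ δ3)) inner₁)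
               (sub-lett-bodyʳ (δ1 ++ Θ1 ++ μ1) ε' (δ1 ++ Θ1 ++ μ1 ++ Γt ++ ν2) δ3 ν2 _ t u2
                   (xyzw≡[xyz]w δ1 Θ1 μ1 (Γt ++ ν2)) refl _)
        inner₂ = sub-lett-bodyʳ ε ε' (δ1 ++ a1 ∷ δ2) δ3 ν2 s t u2
            (sym (++-assoc δ1 (a1 ∷ μ1) (Γt ++ ν2))) refl (second-position δ1 a1 δ2 a2 δ3 e1)
        rhs≅ = ≅-trans (sub-congˡ (++-assoc δ1 (a1 ∷ δ2) (Θ2 ++ δ3)) inner₂)
               (sub-lett-bodyˡ ε (ν2 ++ Θ2 ++ δ3) δ1 (δ2 ++ Θ2 ++ δ3) μ1 _ t u1 refl _)
        e1' = trans (bodyˡ-position as ε' refl)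
            (cong (λ z → δ1 ++ a1 ∷ z) (xyzw≡[xyz]w μ1 as ν2 (a2 ∷ δ3)))
        ih = sub-comm δ1 (μ1 ++ as ++ ν2) δ3 s u1 u2 e1'
        body≅ = castˡ {p = sym (xyzw≡[xyz]w (δ1 ++ Θ1 ++ μ1) as ν2 (Θ2 ++ δ3))}
               (≅-trans (sub-cong _ (xyzw≡[xyz]w δ1 Θ1 (μ1 ++ as ++ ν2) (a2 ∷ δ3))
                   ([xyz]wv≡xyzwv δ1 Θ1 μ1 as ν2) refl
                          (castˡ {p = xyzw≡[xyz]w δ1 Θ1 μ1 (as ++ ε')}
                              (sub-resplit _ e1' refl (xyzw≡[xyz]w μ1 as ν2 (a2 ∷ δ3)) s u1)) hrefl)
               (≅-trans ih (≅-sym (castˡ {p = xyzw≡[xyz]w δ1 Θ1 μ1 (as ++ ν2 ++ Θ2 ++ δ3)}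
                   (sub-cong _ (++-assoc δ1 (a1 ∷ μ1 ++ as ++ ν2) (Θ2 ++ δ3)) refl
                       (xyzw≡[xyz]w μ1 as ν2 (Θ2 ++ δ3))
                      (castˡ {p = sym (xyzw≡[xyz]w ε as ν2 (Θ2 ++ δ3))}
                          (sub-resplit _ (second-position δ1 a1 (μ1 ++ as ++ ν2) a2 δ3 e1')
                          (++-assoc δ1 (a1 ∷ μ1) (as ++ ν2)) refl s u2)) hrefl)))))
    in ≅-trans lhs≅ (≅-trans (lett-cong refl refl body≅ hrefl) (≅-sym rhs≅))
  sub-comm {a1 = a1} {a2 = a2} {Θ1 = Θ1} {Θ2 = Θ2} δ1 δ2 δ3 (lett ε ε' s t) u1 u2 e1
    | in-arg μ1 ν1 refl refl q1 | in-arg μ2 ν2 p2 r2 refl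
      with ++-cancelˡ ε _ _ (trans (sym (++-assoc ε μ1 (a1 ∷ δ2))) p2)
  ...   | refl with ++-∷-cancelˡ μ1 (trans r2 (++-assoc μ1 (a1 ∷ δ2) (a2 ∷ ν2)))
  ...     | refl =
    let inner₁ = sub-lett-arg ε ε' (ε ++ μ1) _ μ1 ν1 s t u1 refl refl e1
        lhs≅ = ≅-trans (sub-congˡ (xyzw≡[xyz]w δ1 Θ1 δ2 (a2 ∷ δ3)) inner₁)
               (sub-lett-arg ε ε' _ δ3 (μ1 ++ Θ1 ++ δ2) ν2 s _ u2 (++-assoc ε μ1 _)
                   (xyzw≡[xyz]w μ1 Θ1 δ2 (a2 ∷ ν2)) _)
        inner₂ = sub-lett-arg ε ε' ((ε ++ μ1) ++ a1 ∷ δ2) δ3 (μ1 ++ a1 ∷ δ2) ν2 s t u2 (++-assoc ε μ1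
            (a1 ∷ δ2))
               (sym (++-assoc μ1 (a1 ∷ δ2) (a2 ∷ ν2))) (second-position δ1 a1 δ2 a2 δ3 e1)
        rhs≅ = ≅-trans (sub-congˡ (++-assoc δ1 (a1 ∷ δ2) (Θ2 ++ δ3)) inner₂)
               (sub-lett-arg ε ε' (ε ++ μ1) _ μ1 (δ2 ++ Θ2 ++ ν2) s _ u1 refl
                   (++-assoc μ1 (a1 ∷ δ2) (Θ2 ++ ν2)) _)
    in ≅-trans lhs≅ (≅-trans (lett-cong refl refl hrefl (sub-comm μ1 δ2 ν2 t u1 u2 refl)) (≅-sym rhs≅))
  sub-comm {a1 = a1} {a2 = a2} {Θ1 = Θ1} {Θ2 = Θ2} δ1 δ2 δ3 (lett ε ε' s t) u1 u2 e1
    | in-arg μ1 ν1 refl refl q1 | in-bodyʳ ν2 p2 refl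
      with ++-∷-cancelˡ μ1 (trans (++-cancelˡ ε _ _ (trans (sym (++-assoc ε μ1 (a1 ∷ δ2))) p2))
          (++-assoc μ1 (a1 ∷ ν1) ν2))
  ...   | refl =
    let inner₁ = sub-lett-arg ε ε' (ε ++ μ1) _ μ1 ν1 s t u1 refl refl e1
        lhs≅ = ≅-trans (sub-congˡ (xyzw≡[xyz]w δ1 Θ1 δ2 (a2 ∷ δ3)) inner₁)
               (sub-lett-bodyʳ ε ε' _ δ3 ν2 s _ u2 ([xy]zwv≡x[yzw]v ε μ1 Θ1 ν1 ν2) refl _)
        inner₂ = sub-lett-bodyʳ ε ε' ((ε ++ μ1) ++ a1 ∷ δ2) δ3 ν2 s t u2 ([xy]zw≡x[yz]w ε μ1
            (a1 ∷ ν1) ν2) refl (second-position δ1 a1 δ2 a2 δ3 e1)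
        rhs≅ = ≅-trans (sub-congˡ (++-assoc δ1 (a1 ∷ δ2) (Θ2 ++ δ3)) inner₂)
               (sub-lett-arg ε (ν2 ++ Θ2 ++ δ3) (ε ++ μ1) _ μ1 ν1 _ t u1 refl refl _)
    in ≅-trans lhs≅ (≅-sym rhs≅)
  sub-comm {a1 = a1} {a2 = a2} {Θ1 = Θ1} {Θ2 = Θ2} δ1 δ2 δ3 (lett {γ = Γt} {as = as} ε ε' s t) u1 u2 e1
    | in-bodyʳ ν1 refl refl | in-bodyʳ ν2 p2 q2
      with ++-cancelˡ Γt _ _ (++-cancelˡ ε _ _ (trans (sym ([xyz]w≡xyzw ε Γt ν1 (a1 ∷ δ2))) p2))
  ...   | refl =
    let inner₁ = sub-lett-bodyʳ ε ε' δ1 _ ν1 s t u1 refl refl e1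
        lhs≅ = ≅-trans (sub-congˡ (xyzw≡[xyz]w δ1 Θ1 δ2 (a2 ∷ δ3)) inner₁)
               (sub-lett-bodyʳ ε _ ((ε ++ Γt ++ ν1) ++ Θ1 ++ δ2) δ3 (ν1 ++ Θ1 ++ δ2) _ t u2
                   ([xyz]wv≡xyzwv ε Γt ν1 Θ1 δ2) (xyzw≡[xyz]w ν1 Θ1 δ2 (a2 ∷ δ3)) _)
        inner₂ = sub-lett-bodyʳ ε ε' ((ε ++ Γt ++ ν1) ++ a1 ∷ δ2) δ3 (ν1 ++ a1 ∷ δ2) s t u2
               ([xyz]w≡xyzw ε Γt ν1 (a1 ∷ δ2))
               (sym (++-assoc ν1 (a1 ∷ δ2) (a2 ∷ δ3))) (second-position δ1 a1 δ2 a2 δ3 e1)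
        rhs≅ = ≅-trans (sub-congˡ (++-assoc δ1 (a1 ∷ δ2) (Θ2 ++ δ3)) inner₂)
               (sub-lett-bodyʳ ε _ (ε ++ Γt ++ ν1) (δ2 ++ Θ2 ++ δ3) ν1 _ t u1 refl
                   (++-assoc ν1 (a1 ∷ δ2) (Θ2 ++ δ3)) _)
        ih = sub-comm (ε ++ as ++ ν1) δ2 δ3 s u1 u2 (bodyʳ-position ε as refl)
        body≅ = castˡ {p = sym (xyzw≡[xyz]w ε as (ν1 ++ Θ1 ++ δ2) (Θ2 ++ δ3))}
               (≅-trans (sub-cong _ (xyzw≡[xyz]w (ε ++ as ++ ν1) Θ1 δ2 (a2 ∷ δ3))
                   (xyzw≡[xyz]w ε as ν1 (Θ1 ++ δ2)) refl
                          (castˡ {p = sym (xyzw≡[xyz]w ε as ν1 (Θ1 ++ δ2 ++ a2 ∷ δ3))} hrefl) hrefl)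
               (≅-trans ih (≅-sym (castˡ {p = sym (xyzw≡[xyz]w ε as ν1 (Θ1 ++ δ2 ++ Θ2 ++ δ3))}
                   (sub-cong _ (++-assoc (ε ++ as ++ ν1) (a1 ∷ δ2) (Θ2 ++ δ3)) refl refl
                      (castˡ {p = sym (xyzw≡[xyz]w ε as (ν1 ++ a1 ∷ δ2) (Θ2 ++ δ3))}
                         (sub-resplit _
                             (second-position (ε ++ as ++ ν1) a1 δ2 a2 δ3
                             (bodyʳ-position ε as refl))
                           (xyzw≡[xyz]w ε as ν1 (a1 ∷ δ2)) refl s u2)) hrefl)))))
    in ≅-trans lhs≅ (≅-trans (lett-cong refl ([xyz]w≡xyzw ν1 Θ1 δ2 (Θ2 ++ δ3)) body≅ hrefl) (≅-sym rhs≅))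
  subS-comm δ1 δ2 δ3 []ₜ u1 u2 e1 = ⊥-elim ([]≢xs++y∷ys δ1 e1)
  subS-comm {a1 = a1} {a2 = a2} δ1 δ2 δ3 (_∷ₜ_ {γ = Γs} {Γ = Γss} s ss) u1 u2 e1
    with cons-position Γs Γss δ1 a1 (δ2 ++ a2 ∷ δ3) e1
       | cons-position Γs Γss (δ1 ++ a1 ∷ δ2) a2 δ3 (second-position δ1 a1 δ2 a2 δ3 e1)
  ... | in-tail μ1 refl q1 | in-head μ2 p2 q2 =
    ⊥-elim (xs≢xs++ys++z∷zs Γs μ1 (trans p2 ([[xy]z]w≡xyzw Γs μ1 (a1 ∷ δ2) (a2 ∷ μ2))))
  subS-comm {a1 = a1} {a2 = a2} {Θ1 = Θ1} {Θ2 = Θ2} δ1 δ2 δ3 (s ∷ₜ ss) u1 u2 e1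
    | in-head μ1 refl q1 | in-head μ2 p2 refl
      with ++-∷-cancelˡ δ1 (trans p2 (++-assoc δ1 (a1 ∷ δ2) (a2 ∷ μ2)))
  ...   | refl =
    let inner₁ = subS-head δ1 _ μ1 s ss u1 refl e1
        lhs≅ = ≅ₛ-trans (subS-congˡ (xyzw≡[xyz]w δ1 Θ1 δ2 (a2 ∷ δ3)) inner₁)
               (subS-head (δ1 ++ Θ1 ++ δ2) δ3 μ2 _ ss u2 (xyzw≡[xyz]w δ1 Θ1 δ2 (a2 ∷ μ2)) _)
        inner₂ = subS-head (δ1 ++ a1 ∷ δ2) δ3 μ2 s ss u2
            (sym (++-assoc δ1 (a1 ∷ δ2) (a2 ∷ μ2))) (second-position δ1 a1 δ2 a2 δ3 e1)
        rhs≅ = ≅ₛ-trans (subS-congˡ (++-assoc δ1 (a1 ∷ δ2) (Θ2 ++ δ3)) inner₂)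
               (subS-head δ1 (δ2 ++ Θ2 ++ δ3) (δ2 ++ Θ2 ++ μ2) _ ss u1
                   (++-assoc δ1 (a1 ∷ δ2) (Θ2 ++ μ2)) _)
    in ≅ₛ-trans lhs≅ (≅ₛ-trans (∷ₜ-cong (sub-comm δ1 δ2 μ2 s u1 u2 refl) hrefl) (≅ₛ-sym rhs≅))
  subS-comm {a1 = a1} {a2 = a2} {Θ1 = Θ1} {Θ2 = Θ2} δ1 δ2 δ3 (s ∷ₜ ss) u1 u2 e1
    | in-head μ1 refl q1 | in-tail μ2 p2 refl
      with ++-∷-cancelˡ δ1 (trans p2 (++-assoc δ1 (a1 ∷ μ1) μ2))
  ...   | refl =
    let inner₁ = subS-head δ1 _ μ1 s ss u1 refl e1
        lhs≅ = ≅ₛ-trans (subS-congˡ (xyzw≡[xyz]w δ1 Θ1 δ2 (a2 ∷ δ3)) inner₁)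
               (subS-tail (δ1 ++ Θ1 ++ μ1 ++ μ2) δ3 μ2 _ ss u2 (xyzw≡[xyz]w δ1 Θ1 μ1 μ2) refl _)
        inner₂ = subS-tail (δ1 ++ a1 ∷ μ1 ++ μ2) δ3 μ2 s ss u2
            (sym (++-assoc δ1 (a1 ∷ μ1) μ2)) refl (second-position δ1 a1 δ2 a2 δ3 e1)
        rhs≅ = ≅ₛ-trans (subS-congˡ (++-assoc δ1 (a1 ∷ δ2) (Θ2 ++ δ3)) inner₂)
               (subS-head δ1 _ μ1 s _ u1 refl _)
    in ≅ₛ-trans lhs≅ (≅ₛ-sym rhs≅)
  subS-comm {a1 = a1} {a2 = a2} {Θ1 = Θ1} {Θ2 = Θ2} δ1 δ2 δ3 (_∷ₜ_ {γ = Γs} s ss) u1 u2 e1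
    | in-tail μ1 refl refl | in-tail μ2 p2 q2
      with ++-cancelˡ Γs _ _ (trans (sym (++-assoc Γs μ1 (a1 ∷ δ2))) p2)
  ...   | refl =
    let inner₁ = subS-tail (Γs ++ μ1) _ μ1 s ss u1 refl refl e1
        lhs≅ = ≅ₛ-trans (subS-congˡ (xyzw≡[xyz]w δ1 Θ1 δ2 (a2 ∷ δ3)) inner₁)
               (subS-tail _ δ3 (μ1 ++ Θ1 ++ δ2) s _ u2 (++-assoc Γs μ1 _)
                   (xyzw≡[xyz]w μ1 Θ1 δ2 (a2 ∷ δ3)) _)
        inner₂ = subS-tail ((Γs ++ μ1) ++ a1 ∷ δ2) δ3 (μ1 ++ a1 ∷ δ2) s ss u2 (++-assoc Γs μ1 (a1 ∷ δ2))
               (sym (++-assoc μ1 (a1 ∷ δ2) (a2 ∷ δ3))) (second-position δ1 a1 δ2 a2 δ3 e1)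
        rhs≅ = ≅ₛ-trans (subS-congˡ (++-assoc δ1 (a1 ∷ δ2) (Θ2 ++ δ3)) inner₂)
               (subS-tail (Γs ++ μ1) _ μ1 s _ u1 refl (++-assoc μ1 (a1 ∷ δ2) (Θ2 ++ δ3)) _)
    in ≅ₛ-trans lhs≅ (≅ₛ-trans (∷ₜ-cong hrefl (subS-comm μ1 δ2 δ3 ss u1 u2 refl)) (≅ₛ-sym rhs≅))

  subMany-single : ∀ {Γ c b} δ δ' (s : Tm (δ ++ c ∷ δ') b) (u : Tm Γ c) →
      subMany δ δ' s (u ∷ₜ []ₜ) ≅ sub δ δ' refl s u
  subMany-single {Γ} δ δ' s u = castˡ {p = [xy]zw≡x[yz]w δ Γ [] δ'}
      (castˡ {p = xyzw≡[xy]zw δ Γ [] δ'} hrefl)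

  subMany-vars : ∀ {b} δ δ' as (s : Tm (δ ++ as ++ δ') b) → subMany δ δ' s (vars as) ≅ s
  subMany-vars δ δ' [] s = hrefl
  subMany-vars δ δ' (c ∷ cs) s =
    castˡ (≅-trans (subMany-vars (δ ++ [ c ]) δ' cs _) (castˡ (sub-identity δ _ refl s)))

  subMany-cong : ∀ {Γ as b} {δ₁ δ₁' δ₂ δ₂' : Ctx}
                 {s₁ : Tm (δ₁ ++ as ++ δ₁') b} {s₂ : Tm (δ₂ ++ as ++ δ₂') b} (ts : Tms Γ as) →
                 δ₁ ≡ δ₂ → δ₁' ≡ δ₂' → s₁ ≅ s₂ → subMany δ₁ δ₁' s₁ ts ≅ subMany δ₂ δ₂' s₂ ts
  subMany-cong ts refl refl hrefl = hrefl

  subMany-castTms : ∀ {Γ Γ' as b} (δ δ' : Ctx) (s : Tm (δ ++ as ++ δ') b) (p : Γ ≡ Γ') (ts : Tms Γ as) →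
                    subMany δ δ' s (castTms p ts) ≅ subMany δ δ' s ts
  subMany-castTms δ δ' s refl ts = hrefl

  -- The terms s', M (and s'' below) are arbitrary representatives, up to ≅, of the expected
  -- subterms; this lets callers absorb context casts.
  subMany-++ : ∀ {Γ₁ Γ₂ as₁ as₂ b} (δ δ' : Ctx) (s : Tm (δ ++ (as₁ ++ as₂) ++ δ') b)
    (ts : Tms Γ₁ as₁) (us : Tms Γ₂ as₂)
    (s' : Tm (δ ++ as₁ ++ as₂ ++ δ') b) → s' ≅ s →
    (M : Tm ((δ ++ Γ₁) ++ as₂ ++ δ') b) → M ≅ subMany δ (as₂ ++ δ') s' ts →
    subMany δ δ' s (ts ++ₜ us) ≅ subMany (δ ++ Γ₁) δ' M us
  subMany-++ δ δ' s []ₜ us s' hs0 M hM =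
    subMany-cong us (sym (++-identityʳ δ)) refl (≅-sym (≅-trans hM hs0))
  subMany-++ {as₂ = as₂} δ δ' s (_∷ₜ_ {γ = γt} {Γ = Γ₁'} {a = c} {as = as₁'} t ts') us s' hs0 M hM =
    let S = castTm (xyzw≡[xy]zw δ γt (as₁' ++ as₂) δ') (sub δ ((as₁' ++ as₂) ++ δ') refl s t)
        S' = castTm (xyzw≡[xy]zw δ γt as₁' (as₂ ++ δ')) (sub δ (as₁' ++ as₂ ++ δ') refl s' t)
        hS : S' ≅ S
        hS = castˡ (≅-trans (sub-cong refl refl refl (sym (++-assoc as₁' as₂ δ')) hs0 hrefl)
                            (≅-sym (castˡ hrefl)))
        pM = cong (λ z → z ++ as₂ ++ δ') (sym (++-assoc δ γt Γ₁'))
        M' = castTm pM M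
        hM' : M' ≅ subMany (δ ++ γt) (as₂ ++ δ') S' ts'
        hM' = castˡ (≅-trans hM (castˡ {p = [xy]zw≡x[yz]w δ γt Γ₁' (as₂ ++ δ')} hrefl))
    in ≅-trans (subMany-castTms δ δ' s (sym (++-assoc γt Γ₁' _)) (t ∷ₜ (ts' ++ₜ us)))
       (≅-trans (castˡ {p = [xy]zw≡x[yz]w δ γt (Γ₁' ++ _) δ'} hrefl)
       (≅-trans (subMany-++ (δ ++ γt) δ' S ts' us S' hS M' hM')
               (subMany-cong us (++-assoc δ γt Γ₁') refl (castˡ hrefl))))

  subMany-sub-commˡ : ∀ {Γ γ b a2 Θ2} (δ1 δ2 δ3 : Ctx) (s : Tm (δ1 ++ γ ++ δ2 ++ a2 ∷ δ3) b)
    (ts : Tms Γ γ) (u2 : Tm Θ2 a2)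
    (e : δ1 ++ γ ++ δ2 ++ a2 ∷ δ3 ≡ (δ1 ++ γ ++ δ2) ++ a2 ∷ δ3)
    (s' : Tm (δ1 ++ γ ++ δ2 ++ Θ2 ++ δ3) b) → s' ≅ sub (δ1 ++ γ ++ δ2) δ3 e s u2 →
    (e' : δ1 ++ Γ ++ δ2 ++ a2 ∷ δ3 ≡ (δ1 ++ Γ ++ δ2) ++ a2 ∷ δ3) →
    subMany δ1 (δ2 ++ Θ2 ++ δ3) s' ts ≅ sub (δ1 ++ Γ ++ δ2) δ3 e' (subMany δ1 (δ2 ++ a2 ∷ δ3) s ts) u2
  subMany-sub-commˡ δ1 δ2 δ3 s []ₜ u2 e s' hs' e' = ≅-trans hs' (sub-resplit e e' refl refl s u2)
  subMany-sub-commˡ {a2 = a2} {Θ2} δ1 δ2 δ3 s (_∷ₜ_ {γ = γt} {Γ = Γ'} {a = c}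
      {as = γ'} t ts') u2 e s' hs' e' =
    let S = castTm (xyzw≡[xy]zw δ1 γt γ' (δ2 ++ a2 ∷ δ3)) (sub δ1 (γ' ++ δ2 ++ a2 ∷ δ3) refl s t)
        S'' = castTm (xyzw≡[xy]zw δ1 γt γ' (δ2 ++ Θ2 ++ δ3)) (sub δ1 (γ' ++ δ2 ++ Θ2 ++ δ3) refl s' t)
        e1 = cong (λ z → δ1 ++ c ∷ z) (sym (++-assoc γ' δ2 (a2 ∷ δ3)))
        eS = xyzw≡[xyz]w (δ1 ++ γt) γ' δ2 (a2 ∷ δ3)
        hS'' : S'' ≅ sub ((δ1 ++ γt) ++ γ' ++ δ2) δ3 eS S u2
        hS'' = castˡ
          (≅-trans (sub-cong refl _ refl (sym (++-assoc γ' δ2 (Θ2 ++ δ3)))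
                     (≅-trans hs' (sub-resplit e (second-position δ1 c (γ' ++ δ2) a2 δ3 e1) refl refl s u2))
                     hrefl)
                (≅-trans (≅-sym (sub-comm δ1 (γ' ++ δ2) δ3 s t u2 e1))
                   (sub-cong _ eS (sym (++-assoc δ1 γt _)) refl
                      (≅-trans (sub-resplit e1 refl refl (++-assoc γ' δ2 (a2 ∷ δ3)) s t)
                          (≅-sym (castˡ {p = xyzw≡[xy]zw δ1 γt γ' (δ2 ++ a2 ∷ δ3)} hrefl))) hrefl)))
        ih = subMany-sub-commˡ (δ1 ++ γt) δ2 δ3 S ts' u2 eS S'' hS''
               (xyzw≡[xyz]w (δ1 ++ γt) Γ' δ2 (a2 ∷ δ3))
    in ≅-trans (castˡ {p = [xy]zw≡x[yz]w δ1 γt Γ' (δ2 ++ Θ2 ++ δ3)} ih)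
         (sub-cong _ e' ([xy]zw≡x[yz]w δ1 γt Γ' δ2) refl
             (≅-sym (castˡ {p = [xy]zw≡x[yz]w δ1 γt Γ' (δ2 ++ a2 ∷ δ3)} hrefl)) hrefl)

  subMany-sub-commʳ : ∀ {Δ Γ γ b a1 Θ1} (δ1 δ2 δ3 : Ctx) (s : Tm Δ b)
    (eq0 : Δ ≡ δ1 ++ a1 ∷ δ2 ++ γ ++ δ3) (ts : Tms Γ γ) (u1 : Tm Θ1 a1)
    (s' : Tm ((δ1 ++ a1 ∷ δ2) ++ γ ++ δ3) b) → s' ≅ s →
    (s'' : Tm ((δ1 ++ Θ1 ++ δ2) ++ γ ++ δ3) b) → s'' ≅ sub δ1 (δ2 ++ γ ++ δ3) eq0 s u1 →
    (e : (δ1 ++ a1 ∷ δ2) ++ Γ ++ δ3 ≡ δ1 ++ a1 ∷ δ2 ++ Γ ++ δ3) →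
    sub δ1 (δ2 ++ Γ ++ δ3) e (subMany (δ1 ++ a1 ∷ δ2) δ3 s' ts) u1 ≅ subMany (δ1 ++ Θ1 ++ δ2) δ3 s'' ts
  subMany-sub-commʳ δ1 δ2 δ3 s eq0 []ₜ u1 s' hs' s'' hs'' e =
    ≅-trans (sub-cong e eq0 refl refl hs' hrefl) (≅-sym hs'')
  subMany-sub-commʳ {a1 = a1} {Θ1} δ1 δ2 δ3 s eq0 (_∷ₜ_ {γ = γt} {Γ = Γ'} {a = c}
      {as = γ'} t ts') u1 s' hs' s'' hs'' e =
    let S = castTm (xyzw≡[xy]zw (δ1 ++ a1 ∷ δ2) γt γ' δ3) (sub (δ1 ++ a1 ∷ δ2) (γ' ++ δ3) refl s' t)
        S2 = castTm (xyzw≡[xy]zw (δ1 ++ Θ1 ++ δ2) γt γ' δ3) (sub (δ1 ++ Θ1 ++ δ2) (γ' ++ δ3) refl s'' t)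
        sIH = sub (δ1 ++ a1 ∷ δ2) (γ' ++ δ3) refl s' t
        eqIH = trans (++-assoc δ1 (a1 ∷ δ2) (γt ++ γ' ++ δ3))
            (cong (λ z → δ1 ++ a1 ∷ z) (sym (++-assoc δ2 γt (γ' ++ δ3))))
        q = cong (λ z → z ++ γ' ++ δ3) (++-assoc δ1 (a1 ∷ δ2) γt)
        S' = castTm q S
        hS' : S' ≅ sIH
        hS' = castˡ {p = q} (castˡ {p = xyzw≡[xy]zw (δ1 ++ a1 ∷ δ2) γt γ' δ3} hrefl)
        q2 = cong (λ z → z ++ γ' ++ δ3) ([xyz]w≡xyzw δ1 Θ1 δ2 γt)
        S2' = castTm q2 S2
        hS2' : S2' ≅ sub δ1 ((δ2 ++ γt) ++ γ' ++ δ3) eqIH sIH u1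
        hS2' = castˡ {p = q2} (castˡ {p = xyzw≡[xy]zw (δ1 ++ Θ1 ++ δ2) γt γ' δ3}
            (≅-trans (sub-cong refl (xyzw≡[xyz]w δ1 Θ1 δ2 (c ∷ γ' ++ δ3)) refl refl hs'' hrefl)
                 (≅-trans (sub-comm δ1 δ2 (γ' ++ δ3) s u1 t eq0)
                    (sub-cong _ eqIH refl (sym (++-assoc δ2 γt _))
                        (sub-cong _ refl refl refl (≅-sym hs') hrefl) hrefl))))
        ih = subMany-sub-commʳ δ1 (δ2 ++ γt) δ3 sIH eqIH ts' u1 S' hS' S2' hS2'
               (++-assoc δ1 (a1 ∷ δ2 ++ γt) (Γ' ++ δ3))
    in ≅-trans (sub-cong e _ refl (sym ([xy]zw≡x[yz]w δ2 γt Γ' δ3))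
                 (castˡ {p = [xy]zw≡x[yz]w (δ1 ++ a1 ∷ δ2) γt Γ' δ3}
                   (subMany-cong ts' (++-assoc δ1 (a1 ∷ δ2) γt) refl (≅-sym (castˡ {p = q} hrefl))))
                 hrefl)
         (≅-trans ih (≅-sym
           (castˡ {p = [xy]zw≡x[yz]w (δ1 ++ Θ1 ++ δ2) γt Γ' δ3}
             (subMany-cong ts' ([xyz]w≡xyzw δ1 Θ1 δ2 γt) refl (≅-sym (castˡ {p = q2} hrefl))))))

  comp1-sub : ∀ {Γ c b} (h : Tm [ c ] b) (s : Tm Γ c) → comp1 h s ≅ sub [] [] refl h s
  comp1-sub {Γ} {c} h s = castˡ {p = ++-identityʳ Γ} (castˡ {p = ++-identityʳ (Γ ++ [])}
    (≅-trans (subMany-single [] [] (castTm (sym (++-identityʳ [ c ])) h) s)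
             (sub-cong {δ₁ = []} {[]} {[]} {[]} refl refl {s₂ = h} {u₁ = s} refl refl
                 (castˡ {p = sym (++-identityʳ [ c ])} hrefl) hrefl)))

  β-step : ∀ {Γ a} {s t : Tm Γ a} → Comp BetaRoot s t → s ∼ t
  β-step c = inc (inj₂ (inj₁ c))

  η-step : ∀ {Γ a} {s t : Tm Γ a} → EtaE s t → s ∼ t
  η-step c = inc (inj₂ (inj₂ c))

  ≡str-step : ∀ {Γ a} {s t : Tm Γ a} → Comp StrRoot s t → s ∼ t
  ≡str-step c = inc (inj₁ (inc c))

  ≡str-lett-body : ∀ {γ as b} (ε ε' : Ctx) {s s' : Tm (ε ++ as ++ ε') b} {t : Tm γ (tensor as)} →
                   s ≡str s' → lett ε ε' s t ≡str lett ε ε' s' t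
  ≡str-lett-body ε ε' (inc c) = inc (letB ε ε' c)
  ≡str-lett-body ε ε' rfl = rfl
  ≡str-lett-body ε ε' (symm p) = symm (≡str-lett-body ε ε' p)
  ≡str-lett-body ε ε' (trans' p q) = trans' (≡str-lett-body ε ε' p) (≡str-lett-body ε ε' q)

  -- There is no such lemma for the argument of a let, where a root η-step is not a →rep step.
  ∼-lett-body : ∀ {γ as b} (ε ε' : Ctx) {s s' : Tm (ε ++ as ++ ε') b} {t : Tm γ (tensor as)} →
                s ∼ s' → lett ε ε' s t ∼ lett ε ε' s' t
  ∼-lett-body ε ε' (inc (inj₁ p)) = inc (inj₁ (≡str-lett-body ε ε' p))
  ∼-lett-body ε ε' (inc (inj₂ (inj₁ c))) = β-step (letB ε ε' c)
  ∼-lett-body ε ε' (inc (inj₂ (inj₂ e))) = η-step (inside (letBN ε ε' e))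
  ∼-lett-body ε ε' rfl = rfl
  ∼-lett-body ε ε' (symm p) = symm (∼-lett-body ε ε' p)
  ∼-lett-body ε ε' (trans' p q) = trans' (∼-lett-body ε ε' p) (∼-lett-body ε ε' q)

  ¬IsLT-var : ∀ {as} → ¬ IsLT (var {a = tensor as})
  ¬IsLT-var (θ , L , ss , e) = plug-tup-≢-var L ss (subst IsVar (sym e) tt)
    where
      IsVar : ∀ {Γ c} → Tm Γ c → Set
      IsVar var = ⊤
      IsVar _ = ⊥
      plug-tup-≢-var : ∀ {θ θ' bs} (L : LCtx θ θ') (ss : Tms θ bs) → ¬ IsVar (plugL L (tup ss))
      plug-tup-≢-var hole ss ()
      plug-tup-≢-var (wrap ε ε' L t) ss ()

  infix 4 _≈_
  data _≈_ {Γ a} (t : Tm Γ a) : ∀ {Γ'} → Tm Γ' a → Set where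
    ∼⇒≈ : ∀ {t'} → t ∼ t' → t ≈ t'

  ≈-sym : ∀ {Γ Γ' a} {t : Tm Γ a} {t' : Tm Γ' a} → t ≈ t' → t' ≈ t
  ≈-sym (∼⇒≈ p) = ∼⇒≈ (symm p)

  ≈-trans : ∀ {Γ Γ' Γ'' a} {t : Tm Γ a} {t' : Tm Γ' a} {t'' : Tm Γ'' a} → t ≈ t' → t' ≈ t'' → t ≈ t''
  ≈-trans (∼⇒≈ p) (∼⇒≈ q) = ∼⇒≈ (trans' p q)

  ≅⇒≈ : ∀ {Γ Γ' a} {t : Tm Γ a} {t' : Tm Γ' a} → t ≅ t' → t ≈ t'
  ≅⇒≈ hrefl = ∼⇒≈ rfl

  ≈⇒∼ : ∀ {Γ a} {t t' : Tm Γ a} → t ≈ t' → t ∼ t'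
  ≈⇒∼ (∼⇒≈ p) = p

  module ≈-Reasoning where
    infix  1 begin_
    infixr 2 _≈⟨_⟩_ _≈⟨_⟨_ _∼⟨_⟩_ _∼⟨_⟨_ _≅⟨_⟩_ _≅⟨_⟨_
    infix  3 _∎

    begin_ : ∀ {Γ Γ' a} {t : Tm Γ a} {t' : Tm Γ' a} → t ≈ t' → t ≈ t'
    begin p = p

    _≈⟨_⟩_ : ∀ {Γ Γ' Γ'' a} (t : Tm Γ a) {t' : Tm Γ' a} {t'' : Tm Γ'' a} → t ≈ t' → t' ≈ t'' → t ≈ t''
    _ ≈⟨ p ⟩ q = ≈-trans p q

    _≈⟨_⟨_ : ∀ {Γ Γ' Γ'' a} (t : Tm Γ a) {t' : Tm Γ' a} {t'' : Tm Γ'' a} → t' ≈ t → t' ≈ t'' → t ≈ t''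
    _ ≈⟨ p ⟨ q = ≈-trans (≈-sym p) q

    _∼⟨_⟩_ : ∀ {Γ Γ'' a} (t : Tm Γ a) {t' : Tm Γ a} {t'' : Tm Γ'' a} → t ∼ t' → t' ≈ t'' → t ≈ t''
    _ ∼⟨ p ⟩ q = ≈-trans (∼⇒≈ p) q

    _∼⟨_⟨_ : ∀ {Γ Γ'' a} (t : Tm Γ a) {t' : Tm Γ a} {t'' : Tm Γ'' a} → t' ∼ t → t' ≈ t'' → t ≈ t''
    _ ∼⟨ p ⟨ q = ≈-trans (∼⇒≈ (symm p)) q

    _≅⟨_⟩_ : ∀ {Γ Γ' Γ'' a} (t : Tm Γ a) {t' : Tm Γ' a} {t'' : Tm Γ'' a} → t ≅ t' → t' ≈ t'' → t ≈ t''
    _ ≅⟨ p ⟩ q = ≈-trans (≅⇒≈ p) q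

    _≅⟨_⟨_ : ∀ {Γ Γ' Γ'' a} (t : Tm Γ a) {t' : Tm Γ' a} {t'' : Tm Γ'' a} → t' ≅ t → t' ≈ t'' → t ≈ t''
    _ ≅⟨ p ⟨ q = ≈-trans (≅⇒≈ (≅-sym p)) q

    _∎ : ∀ {Γ a} (t : Tm Γ a) → t ≈ t
    _ ∎ = ∼⇒≈ rfl

  ⟨_⟩¹ : ∀ {Γ c} → Tm Γ c → Tm (Γ ++ []) (tensor [ c ])
  ⟨ t ⟩¹ = tup (t ∷ₜ []ₜ)

  trivial-lett : ∀ {γ δ c b} (s : Tm (γ ++ c ∷ δ) b) → s ≈ lett γ δ s ⟨ var ⟩¹
  trivial-lett {γ} {δ} s = begin
      s
    ≅⟨ sub-identity γ δ refl s ⟨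
      sub γ δ refl s var
    ≅⟨ subMany-single γ δ s var ⟨
      subMany γ δ s (var ∷ₜ []ₜ)
    ∼⟨ β-step (root (beta γ δ s hole (var ∷ₜ []ₜ))) ⟨
      lett γ δ s ⟨ var ⟩¹
    ∎
    where open ≈-Reasoning

  module Uncurrying (γ δ as : Ctx) (a : Type) where
    open ≈-Reasoning

    X : Type
    X = tensor as

    ⟨vars⟩ : Tm as X
    ⟨vars⟩ = tup (vars as)

    Λ : Tm (γ ++ X ∷ δ) a → Tm (γ ++ (as ++ []) ++ δ) a
    Λ s = lett γ δ s ⟨ ⟨vars⟩ ⟩¹

    Ψ : Tm (γ ++ as ++ δ) a → Tm (γ ++ X ∷ δ) a
    Ψ w = lett γ δ w var

    Λ≈Φ : (s : Tm (γ ++ X ∷ δ) a) → Λ s ≈ Φ γ δ as s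
    Λ≈Φ s = begin
        Λ s
      ∼⟨ β-step (root (beta γ δ s hole (⟨vars⟩ ∷ₜ []ₜ))) ⟩
        subMany γ δ s (⟨vars⟩ ∷ₜ []ₜ)
      ≅⟨ subMany-single γ δ s ⟨vars⟩ ⟩
        Φ γ δ as s
      ∎

    Φ∼Λ : (s : Tm (γ ++ X ∷ δ) a) →
        Φ γ δ as s ∼ castTm (cong (λ z → γ ++ z ++ δ) (++-identityʳ as)) (Λ s)
    Φ∼Λ s = ≈⇒∼ (≈-trans (≈-sym (Λ≈Φ s)) (≅⇒≈ (castʳ hrefl)))

    Φ-respects-∼ : ∀ {s s' : Tm (γ ++ X ∷ δ) a} → s ∼ s' → Φ γ δ as s ∼ Φ γ δ as s'
    Φ-respects-∼ {s} {s'} p = ≈⇒∼ (begin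
        Φ γ δ as s
      ≈⟨ Λ≈Φ s ⟨
        Λ s
      ∼⟨ ∼-lett-body γ δ p ⟩
        Λ s'
      ≈⟨ Λ≈Φ s' ⟩
        Φ γ δ as s'
      ∎)

    Ψ∘Φ≈id : (s : Tm (γ ++ X ∷ δ) a) → s ≈ Ψ (Φ γ δ as s)
    Ψ∘Φ≈id s = begin
        s
      ≈⟨ trivial-lett s ⟩
        lett γ δ s ⟨ var ⟩¹
      ∼⟨ η-step (inside (letAN γ δ (tupN (hereN (atRoot (eta var ¬IsLT-var)))))) ⟩
        lett γ δ s ⟨ etaExp var ⟩¹
      ≅⟨ lett-cong refl refl hrefl (≅-sym (castˡ (tup-cong (∷ₜ-cong (castˡ hrefl) hrefl)))) ⟩
        lett γ δ s (plugF ⟨[·]⟩¹ [ X ] (lett [] [] ⟨vars⟩′ var))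
      ∼⟨ ≡str-step (letA γ δ (root (str ⟨[·]⟩¹ ⟨vars⟩′ var))) ⟩
        lett γ δ s (lett [] [] (plugF ⟨[·]⟩¹ as ⟨vars⟩′) var)
      ≅⟨ lett-cong refl refl hrefl
          (lett-cong refl refl (castˡ (tup-cong (∷ₜ-cong (castˡ hrefl) hrefl))) hrefl) ⟩
        lett γ δ s (lett [] [] ⟨ ⟨vars⟩ ⟩¹ var)
      ≅⟨ castˡ hrefl ⟨
        plugF (farg γ δ s fhole) [ X ] (lett [] [] ⟨ ⟨vars⟩ ⟩¹ var)
      ∼⟨ ≡str-step (root (str (farg γ δ s fhole) ⟨ ⟨vars⟩ ⟩¹ var)) ⟩
        lett (γ ++ []) ([] ++ δ) (plugF (farg γ δ s fhole) as ⟨ ⟨vars⟩ ⟩¹) var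
      ≅⟨ lett-cong (++-identityʳ γ) refl (castˡ (castʳ {t = Λ s} hrefl)) hrefl ⟩
        lett γ δ (castTm _ (Λ s)) var
      ∼⟨ ∼-lett-body γ δ (Φ∼Λ s) ⟨
        Ψ (Φ γ δ as s)
      ∎
      where
        ⟨[·]⟩¹ : FC [] [] X [] [] (tensor [ X ])
        ⟨[·]⟩¹ = ftup []ₜ fhole []ₜ

        ⟨vars⟩′ : Tm ([] ++ as ++ []) X
        ⟨vars⟩′ = castTm (sym (++-identityʳ as)) ⟨vars⟩

    Φ∘Ψ≈id : (u : Tm (γ ++ as ++ δ) a) → Φ γ δ as (Ψ u) ≈ u
    Φ∘Ψ≈id u = begin
        Φ γ δ as (Ψ u)
      ≈⟨ Λ≈Φ (Ψ u) ⟨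
        lett γ δ (lett γ δ u var) ⟨ ⟨vars⟩ ⟩¹
      ≅⟨ lett-cong (sym (++-identityʳ γ)) refl (≅-sym (castˡ hrefl)) hrefl ⟩
        lett (γ ++ []) ([] ++ δ) (plugF (farg γ δ u fhole) [ X ] var) ⟨ ⟨vars⟩ ⟩¹
      ∼⟨ ≡str-step (root (str (farg γ δ u fhole) var ⟨ ⟨vars⟩ ⟩¹)) ⟨
        plugF (farg γ δ u fhole) (as ++ []) (lett [] [] var ⟨ ⟨vars⟩ ⟩¹)
      ≅⟨ castˡ hrefl ⟩
        lett γ δ u (lett [] [] var ⟨ ⟨vars⟩ ⟩¹)
      ∼⟨ β-step (letA γ δ (root (beta [] [] var hole (⟨vars⟩ ∷ₜ []ₜ)))) ⟩
        lett γ δ u (subMany [] [] var (⟨vars⟩ ∷ₜ []ₜ))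
      ≅⟨ lett-cong refl refl hrefl (≅-trans (subMany-single [] [] var ⟨vars⟩) (sub-var _ refl)) ⟩
        lett γ δ u ⟨vars⟩
      ∼⟨ β-step (root (beta γ δ u hole (vars as))) ⟩
        subMany γ δ u (vars as)
      ≅⟨ subMany-vars γ δ as u ⟩
        u
      ∎

    Φ-injective : ∀ {s s' : Tm (γ ++ X ∷ δ) a} → Φ γ δ as s ∼ Φ γ δ as s' → s ∼ s'
    Φ-injective {s} {s'} p = ≈⇒∼ (begin
        s
      ≈⟨ Ψ∘Φ≈id s ⟩
        Ψ (Φ γ δ as s)
      ∼⟨ ∼-lett-body γ δ p ⟩
        Ψ (Φ γ δ as s')
      ≈⟨ Ψ∘Φ≈id s' ⟨
        s'
      ∎)

    Φ-surjective : (u : Tm (γ ++ as ++ δ) a) → Σ (Tm (γ ++ X ∷ δ) a) (λ s → Φ γ δ as s ∼ u)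
    Φ-surjective u = Ψ u , ≈⇒∼ (Φ∘Ψ≈id u)

    Φ-natural : ∀ {a'} (h : Tm [ a ] a') (s : Tm (γ ++ X ∷ δ) a) →
        Φ γ δ as (comp1 h s) ∼ comp1 h (Φ γ δ as s)
    Φ-natural h s = ≈⇒∼ (begin
        Φ γ δ as (comp1 h s)
      ≅⟨ sub-cong refl (x[ycz]w≡[xy]czw [] γ X δ []) refl (sym (++-identityʳ δ)) (comp1-sub h s) hrefl ⟩
        sub γ (δ ++ []) _ (sub [] [] refl h s) ⟨vars⟩
      ≅⟨ sub-assoc [] [] γ δ refl h s ⟨vars⟩ _ ⟩
        sub [] [] refl h (Φ γ δ as s)
      ≅⟨ comp1-sub h (Φ γ δ as s) ⟨
        comp1 h (Φ γ δ as s)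
      ∎)

    module Multinaturality {Γ₁ Γ₂ : Ctx} (ts : Tms Γ₁ γ) (us : Tms Γ₂ δ) (s : Tm (γ ++ X ∷ δ) a) where

      pad-s : γ ++ X ∷ δ ≡ γ ++ (X ∷ δ) ++ []
      pad-s = cong (γ ++_) (sym (++-identityʳ (X ∷ δ)))

      pad-Φs : γ ++ as ++ δ ≡ γ ++ (as ++ δ) ++ []
      pad-Φs = solve (++-monoid Type)

      pad-δ : γ ++ as ++ δ ≡ γ ++ as ++ δ ++ []
      pad-δ = cong (λ z → γ ++ as ++ z) (sym (++-identityʳ δ))

      s′ : Tm (γ ++ (X ∷ δ) ++ []) a
      s′ = castTm pad-s s

      s[ts] : Tm (Γ₁ ++ (X ∷ δ) ++ []) a
      s[ts] = subMany [] ((X ∷ δ) ++ []) s′ ts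

      s[ts][⟨vars⟩] : Tm (Γ₁ ++ as ++ δ ++ []) a
      s[ts][⟨vars⟩] = sub Γ₁ (δ ++ []) refl s[ts] ⟨vars⟩

      lhs-normal : Φ Γ₁ Γ₂ as (comp s (ts ++ₜ (var ∷ₜ us)))
                   ≅ subMany (Γ₁ ++ as ++ []) [] (castTm
                       (xyzw≡[xyz]w Γ₁ as [] (δ ++ [])) s[ts][⟨vars⟩]) us
      lhs-normal =
        ≅-trans (sub-cong refl (++-assoc Γ₁ [ X ] (Γ₂ ++ [])) refl (sym (++-identityʳ Γ₂))
                  (castˡ {p = ++-identityʳ (Γ₁ ++ X ∷ Γ₂)} (≅-trans split-ts split-var)) hrefl)
                (subMany-sub-commʳ Γ₁ [] [] s[ts] refl us ⟨vars⟩ s[ts][var] s[ts][var]≅s[ts]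
                  _ (castˡ {p = xyzw≡[xyz]w Γ₁ as [] (δ ++ [])} hrefl) (++-assoc Γ₁ [ X ] (Γ₂ ++ [])))
        where
          split-ts : subMany [] [] (castTm (sym (++-identityʳ (γ ++ X ∷ δ))) s) (ts ++ₜ (var ∷ₜ us))
                     ≅ subMany Γ₁ [] s[ts] (var ∷ₜ us)
          split-ts = subMany-++ [] [] _ ts (var ∷ₜ us) s′
                       (castˡ {p = pad-s}
                           (≅-sym (castˡ {p = sym (++-identityʳ (γ ++ X ∷ δ))} hrefl))) s[ts] hrefl

          s[ts][var] : Tm ((Γ₁ ++ [ X ]) ++ δ ++ []) a
          s[ts][var] = castTm (xyzw≡[xy]zw Γ₁ [ X ] δ []) (sub Γ₁ (δ ++ []) refl s[ts] var)

          s[ts][var]≅s[ts] : s[ts][var] ≅ s[ts]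
          s[ts][var]≅s[ts] = castˡ {p = xyzw≡[xy]zw Γ₁ [ X ] δ []} (sub-identity Γ₁ (δ ++ []) refl s[ts])

          split-var : subMany Γ₁ [] s[ts] (var ∷ₜ us) ≅ subMany (Γ₁ ++ [ X ]) [] s[ts][var] us
          split-var = castˡ {p = [xy]zw≡x[yz]w Γ₁ [ X ] Γ₂ []} hrefl

      Φs′ : Tm (γ ++ (as ++ δ) ++ []) a
      Φs′ = castTm pad-Φs (Φ γ δ as s)

      Φs[ts] : Tm (Γ₁ ++ (as ++ δ) ++ []) a
      Φs[ts] = subMany [] ((as ++ δ) ++ []) Φs′ ts

      Φs[ts]′ : Tm (Γ₁ ++ as ++ δ ++ []) a
      Φs[ts]′ = castTm (cong (Γ₁ ++_) (++-assoc as δ [])) Φs[ts]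

      rhs-normal : comp (Φ γ δ as s) (ts ++ₜ (vars as ++ₜ us))
                   ≅ subMany (Γ₁ ++ as) [] (castTm (sym (++-assoc Γ₁ as (δ ++ []))) Φs[ts]′) us
      rhs-normal = castˡ {p = ++-identityʳ (Γ₁ ++ as ++ Γ₂)} (≅-trans split-ts split-vars)
        where
          split-ts : subMany [] [] (castTm (sym (++-identityʳ (γ ++ as ++ δ))) (Φ γ δ as s))
                             (ts ++ₜ (vars as ++ₜ us))
                     ≅ subMany Γ₁ [] Φs[ts] (vars as ++ₜ us)
          split-ts = subMany-++ [] [] _ ts (vars as ++ₜ us) Φs′
                       (castˡ {p = pad-Φs}
                           (≅-sym (castˡ {p = sym (++-identityʳ (γ ++ as ++ δ))} hrefl))) Φs[ts] hrefl

          split-vars : subMany Γ₁ [] Φs[ts] (vars as ++ₜ us)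
                       ≅ subMany (Γ₁ ++ as) [] (castTm (sym (++-assoc Γ₁ as (δ ++ []))) Φs[ts]′) us
          split-vars = subMany-++ Γ₁ [] Φs[ts] (vars as) us Φs[ts]′
                         (castˡ {p = cong (Γ₁ ++_) (++-assoc as δ [])} hrefl) _
                         (castˡ {p = sym (++-assoc Γ₁ as (δ ++ []))}
                             (≅-sym (subMany-vars Γ₁ (δ ++ []) as Φs[ts]′)))

      -- The substitutions of ⟨x⃗⟩ for x and of ts for γ act on disjoint variables, so they commute.
      Φs[ts]≅s[ts][⟨vars⟩] : Φs[ts] ≅ s[ts][⟨vars⟩]
      Φs[ts]≅s[ts][⟨vars⟩] =
        ≅-trans (subMany-cong ts refl (++-assoc as δ [])
                  (castˡ {p = pad-Φs} (≅-sym (castˡ {p = pad-δ} hrefl))))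
          (≅-trans (subMany-sub-commˡ [] [] (δ ++ []) s′ ts ⟨vars⟩ position _ Φs≅sub position′)
                   (sub-resplit position′ refl (++-identityʳ Γ₁) refl s[ts] ⟨vars⟩))
        where
          position : γ ++ X ∷ δ ++ [] ≡ (γ ++ []) ++ X ∷ δ ++ []
          position = xyzw≡[xyz]w [] γ [] (X ∷ δ ++ [])

          position′ : Γ₁ ++ X ∷ δ ++ [] ≡ (Γ₁ ++ []) ++ X ∷ δ ++ []
          position′ = xyzw≡[xyz]w [] Γ₁ [] (X ∷ δ ++ [])

          Φs≅sub : castTm pad-δ (Φ γ δ as s) ≅ sub (γ ++ []) (δ ++ []) position s′ ⟨vars⟩
          Φs≅sub = castˡ {p = pad-δ}
            (sub-cong refl position (sym (++-identityʳ γ)) (sym (++-identityʳ δ))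
                (≅-sym (castˡ {p = pad-s} hrefl)) hrefl)

    Φ-multinatural : ∀ {Γ₁ Γ₂} (ts : Tms Γ₁ γ) (us : Tms Γ₂ δ) (s : Tm (γ ++ X ∷ δ) a) →
      Φ Γ₁ Γ₂ as (comp s (ts ++ₜ (var ∷ₜ us))) ∼ comp (Φ γ δ as s) (ts ++ₜ (vars as ++ₜ us))
    Φ-multinatural {Γ₁} ts us s = ≈⇒∼ (≅⇒≈
      (≅-trans lhs-normal
        (≅-trans (subMany-cong us (cong (Γ₁ ++_) (++-identityʳ as)) refl
                   (castˡ {p = xyzw≡[xyz]w Γ₁ as [] (δ ++ [])}
                     (≅-sym (castˡ {p = sym (++-assoc Γ₁ as (δ ++ []))}
                       (castˡ {p = cong (Γ₁ ++_) (++-assoc as δ [])} Φs[ts]≅s[ts][⟨vars⟩])))))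
          (≅-sym rhs-normal))))
      where open Multinaturality ts us s

proposition3p13 : (𝓡 : Signature) → let open Syntax 𝓡 in
    (γ δ as : Ctx) (a : Type) →
    (∀ {s s' : Tm (γ ++ tensor as ∷ δ) a} → s ∼ s' → Φ γ δ as s ∼ Φ γ δ as s')
    × (∀ {s s' : Tm (γ ++ tensor as ∷ δ) a} → Φ γ δ as s ∼ Φ γ δ as s' → s ∼ s')
    × (∀ (u : Tm (γ ++ as ++ δ) a) →
         Σ (Tm (γ ++ tensor as ∷ δ) a) (λ s → Φ γ δ as s ∼ u))
    × (∀ {Γ₁ Γ₂ : Ctx} (ts : Tms Γ₁ γ) (us : Tms Γ₂ δ) (s : Tm (γ ++ tensor as ∷ δ) a) →
         Φ Γ₁ Γ₂ as (comp s (ts ++ₜ (var ∷ₜ us)))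
           ∼ comp (Φ γ δ as s) (ts ++ₜ (vars as ++ₜ us)))
    × (∀ {a' : Type} (h : Tm [ a ] a') (s : Tm (γ ++ tensor as ∷ δ) a) →
         Φ γ δ as (comp1 h s) ∼ comp1 h (Φ γ δ as s))
proposition3p13 𝓡 γ δ as a =
  Φ-respects-∼ , Φ-injective , Φ-surjective , Φ-multinatural , Φ-natural
  where open Representability.Uncurrying 𝓡 γ δ as a
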